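{- Let $\mathcal{C}$ be a simplicial complex on the ground set $[n]$ and let $\Lambda(\mathcal{C})$ be its Lawrence lifting. Then $\mathcal{A}_{\Lambda(\mathcal{C})}$ is normal if and only if $\mathcal{A}_{\mathcal{C}}$ is unimodular.
   Context: For a simplicial complex $\mathcal{C}$ on ground set $[m]$ and $\mathbf{d}=(d_1,\dots,d_m)$ with all $d_i\ge 2$, the matrix $\mathcal{A}_{\mathcal{C},\mathbf{d}}$ has columns indexed by $\mathbf{i}\in\prod_{j\in[m]}[d_j]$ and rows indexed by pairs $(F,e)$ with $F$ a facet (inclusion-maximal face) of $\mathcal{C}$ and $e\in\prod_{j\in F}[d_j]$; the entry in row $(F,e)$, column $\mathbf{i}$ is $1$ if $e=(i_j:j\in F)$ and $0$ otherwise. Here $\mathbf{d}=(2,\dots,2)$ and $\mathcal{A}_{\mathcal{C}}:=\mathcal{A}_{\mathcal{C},(2,\dots,2)}$. A matrix $A$ with $n$ columns is normal if $\mathbb{R}_{\ge0}A\cap\mathbb{Z}A=\mathbb{N}A$, where $\mathbb{Z}A=\{Az:z\in\mathbb{Z}^n\}$, $\mathbb{R}_{\ge0}A=\{Ar:r\in\mathbb{R}^n_{\ge0}\}$, $\mathbb{N}A=\{Az:z\in\mathbb{N}^n\}$. An integer matrix $A$ is unimodular if for every $b\in\mathbb{Z}A\cap\mathbb{R}_{\ge0}A$ the polyhedron $\{x:Ax=b,\ x\ge0\}$ has all vertices integral. The Lawrence lifting $\Lambda(\mathcal{C})$ of a complex $\mathcal{C}$ on $[n]$ is the simplicial complex on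 $[n+1]$ with facets $\{[n]\}\cup\{F\cup\{n+1\}: F \text{ a facet of } \mathcal{C}\}$.
   Formalization: The cone $\mathbb{R}_{\ge0}A$ and the polyhedron $\{x:Ax=b,\ x\ge0\}$, together with its vertices, are taken over ℚ rather than over the reals. -}

module Defs where

open import Data.Nat using (ℕ; zero; suc)
open import Data.Integer as ℤ using (ℤ; +_)
open import Data.Rational as ℚ using (ℚ; 0ℚ; 1ℚ; _/_)
open import Data.Bool using (Bool; true; false; _∧_; if_then_else_)
open import Data.Vec using (Vec; []; _∷_; _∷ʳ_; replicate; zipWith)
open import Data.Vec.Properties using (≡-dec)
import Data.Bool.Properties as BoolP
open import Data.Fin.Subset using (Subset; _⊆_; ⊤)
open import Data.List using (List; _∷_; map)
open import Data.List.Membership.Propositional using (_∈_)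
open import Data.Product using (Σ; Σ-syntax; ∃; ∃-syntax; _×_; _,_)
open import Relation.Binary.PropositionalEquality using (_≡_)
open import Relation.Nullary.Decidable using (does)

-- A complex is given by a finite list of generating faces; its faces are
-- all subsets of some generator (so it is closed under taking subsets).
-- Every simplicial complex arises this way (take its facets as generators).

SimplicialComplex : ℕ → Set
SimplicialComplex n = List (Subset n)

IsFace : ∀ {n} → SimplicialComplex n → Subset n → Set
IsFace C F = ∃[ G ] (G ∈ C × F ⊆ G)

IsFacet : ∀ {n} → SimplicialComplex n → Subset n → Set
IsFacet C F = IsFace C F × (∀ G → IsFace C G → F ⊆ G → G ≡ F)

-- Lawrence lifting: complex on [n+1] (new vertex n+1 = last element)
-- with facets [n] and F ∪ {n+1} for F a facet of C.
-- (Using all generators of C instead of only its facets yields the same complex.)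
Lawrence : ∀ {n} → SimplicialComplex n → SimplicialComplex (suc n)
Lawrence {n} C = (⊤ {n} ∷ʳ false) ∷ map (λ F → F ∷ʳ true) C

-- The matrix A_C = A_{C,(2,...,2)}.
-- Columns: i ∈ {1,2}^n, encoded as Vec Bool n.
-- Rows: pairs (F , e), F a facet, e ∈ {1,2}^F encoded as a Bool-vector
-- which is false outside F (i.e. e ≡ F ∧ e pointwise).

Column : ℕ → Set
Column n = Vec Bool n

restrict : ∀ {n} → Subset n → Vec Bool n → Vec Bool n
restrict F i = zipWith _∧_ F i

Row : ∀ {n} → SimplicialComplex n → Set
Row {n} C = Σ[ F ∈ Subset n ] Σ[ e ∈ Vec Bool n ] (IsFacet C F × e ≡ restrict F e)

Matrix : Set → ℕ → Set
Matrix R m = R → Column m → ℤ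

𝒜 : ∀ {n} (C : SimplicialComplex n) → Matrix (Row C) n
𝒜 C (F , e , _) i = if does (≡-dec BoolP._≟_ (restrict F i) e) then + 1 else + 0

sumℤ : ∀ m → (Column m → ℤ) → ℤ
sumℤ zero    f = f []
sumℤ (suc m) f = sumℤ m (λ i → f (true ∷ i)) ℤ.+ sumℤ m (λ i → f (false ∷ i))

sumℚ : ∀ m → (Column m → ℚ) → ℚ
sumℚ zero    f = f []
sumℚ (suc m) f = sumℚ m (λ i → f (true ∷ i)) ℚ.+ sumℚ m (λ i → f (false ∷ i))

toℚ : ℤ → ℚ
toℚ z = z / 1

_·ℤ_ : ∀ {R m} → Matrix R m → (Column m → ℤ) → R → ℤ
_·ℤ_ {m = m} A z r = sumℤ m (λ i → A r i ℤ.* z i)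

_·ℕ_ : ∀ {R m} → Matrix R m → (Column m → ℕ) → R → ℤ
_·ℕ_ {m = m} A z r = sumℤ m (λ i → A r i ℤ.* (+ z i))

_·ℚ_ : ∀ {R m} → Matrix R m → (Column m → ℚ) → R → ℚ
_·ℚ_ {m = m} A x r = sumℚ m (λ i → toℚ (A r i) ℚ.* x i)

-- ℤA, ℝ≥0 A (over ℚ), ℕA as predicates on vectors b ∈ ℤ^R.

InLattice : ∀ {R m} → Matrix R m → (R → ℤ) → Set
InLattice {m = m} A b = ∃[ z ] (∀ r → (A ·ℤ z) r ≡ b r)

InSemigroup : ∀ {R m} → Matrix R m → (R → ℤ) → Set
InSemigroup {m = m} A b = ∃[ z ] (∀ r → (A ·ℕ z) r ≡ b r)

InCone : ∀ {R m} → Matrix R m → (R → ℤ) → Set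
InCone {m = m} A b = ∃[ x ] ((∀ i → 0ℚ ℚ.≤ x i) × (∀ r → (A ·ℚ x) r ≡ toℚ (b r)))

-- normal:  ℝ≥0 A ∩ ℤA = ℕA   (the inclusion ℕA ⊆ ℝ≥0 A ∩ ℤA is automatic;
-- we state the equality as the non-trivial inclusion plus the trivial one)
IsNormal : ∀ {R m} → Matrix R m → Set
IsNormal A = ∀ b → (InCone A b × InLattice A b → InSemigroup A b)
                 × (InSemigroup A b → InCone A b × InLattice A b)

InPolyhedron : ∀ {R m} → Matrix R m → (R → ℤ) → (Column m → ℚ) → Set
InPolyhedron A b x = (∀ i → 0ℚ ℚ.≤ x i) × (∀ r → (A ·ℚ x) r ≡ toℚ (b r))

IsVertex : ∀ {R m} → Matrix R m → (R → ℤ) → (Column m → ℚ) → Set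
IsVertex A b x =
  InPolyhedron A b x ×
  (∀ y w (λ′ : ℚ) → InPolyhedron A b y → InPolyhedron A b w →
     0ℚ ℚ.< λ′ → λ′ ℚ.< 1ℚ →
     (∀ i → x i ≡ (λ′ ℚ.* y i) ℚ.+ ((1ℚ ℚ.- λ′) ℚ.* w i)) →
     ∀ i → y i ≡ w i)

IsIntegral : ∀ {m} → (Column m → ℚ) → Set
IsIntegral x = ∀ i → ∃[ z ] (x i ≡ toℚ z)

IsUnimodular : ∀ {R m} → Matrix R m → Set
IsUnimodular A = ∀ b → InLattice A b → InCone A b →
                 ∀ x → IsVertex A b x → IsIntegral x

-- Up to repeated rows, L = 𝒜 (Lawrence C) is the Lawrence lifting [[A, 0], [0, A], [I, I]] of
-- A = 𝒜 C (unless [n] is a face of C; then every coordinate of either matrix is one of its rows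
-- and both properties are trivial). Both properties are then equivalent to box integrality: every
-- box {0 ≤ x ≤ c}, c integral, that meets a fibre {A x = A z} of A in a rational point meets it in
-- an integral point.
-- L normal ⇒ box integral: a box point x gives the point (c − x, x) of the cone of L in the fibre
-- of (c − z, z); normality yields an integral (c − u, u) there.
-- Box integral ⇒ A unimodular: for a vertex x of {x ≥ 0, A x = b} let c i be the numerator of
-- x i, so c ≤ κ x; the box yields an integral u with A u = b and u ≤ κ x, so x ± (u − x) / κ lie in
-- the polyhedron, and as x is their midpoint, x = u.
-- A unimodular ⇒ box integral: a rational box point with fewest coordinates strictly inside
-- (0, c), with its coordinates equal to c lowered to 0, is a vertex of a polyhedron of A, for
-- along a segment through it one more coordinate could be pushed to a bound. Constructively this
-- is an argument by contradiction, made legitimate by searching the finitely many integral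
-- points of the box.
-- Box integral ⇒ L normal: a cone point (x₁, x₂) of L in the fibre of an integral (z₁, z₂) has
-- integral pair sums c = z₁ + z₂ ≥ 0, so x₂ is a box point; an integral u there gives (c − u, u).
{-# OPTIONS --safe #-}
module Submission where

open import Defs
open import Algebra.Bundles using (CommutativeMonoid)
open import Data.Bool using (Bool; true; false; _∧_; if_then_else_)
import Data.Bool.Properties as BoolP
open import Data.Empty using (⊥; ⊥-elim)
import Data.Fin as Fin
open import Data.Fin.Subset using (Subset; _⊆_; ⊤)
open import Data.Fin.Subset.Properties using (drop-∷-⊆; ⊆-antisym; ⊆⊤; _⊆?_; anySubset?)
open import Data.Integer as ℤ using (ℤ; +_; -[1+_])
import Data.Integer.Properties as ℤP
open import Data.List.Membership.Propositional using (_∈_; find; lose)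
open import Data.List.Membership.Propositional.Properties using (∈-map⁺; ∈-map⁻)
open import Data.List.Relation.Unary.Any using (any?) renaming (here to hereˡ; there to thereˡ)
open import Data.Nat as ℕ using (ℕ; zero; suc; _∸_)
open import Data.Nat.Coprimality as Coprimality using ()
import Data.Nat.Properties as ℕP
open import Data.Product using (Σ-syntax; ∃-syntax; _×_; _,_; proj₁; proj₂)
open import Data.Rational as ℚ using (ℚ; 0ℚ; 1ℚ; ½; mkℚ; 1/_; ↥_; ↧ₙ_; _+_; _-_; _*_; -_; _≤_; _<_)
import Data.Rational.Properties as ℚP
open import Data.Rational.Solver using (module +-*-Solver)
import Data.Rational.Unnormalised as ℚᵘ
import Data.Rational.Unnormalised.Properties as ℚᵘP
open import Data.Sum using (_⊎_; inj₁; inj₂)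
open import Data.Vec using (Vec; []; _∷_; _∷ʳ_; init; last; initLast)
open import Data.Vec.Base using (_[_]=_; here; there)
open import Data.Vec.Properties using (≡-dec; init-∷ʳ; last-∷ʳ; ∷ʳ-injective)
open import Function using (_∘_; case_of_)
open import Relation.Binary.Definitions using (tri<; tri≈; tri>)
open import Relation.Binary.PropositionalEquality
open import Relation.Nullary using (¬_; Dec; yes; no; does)
open import Relation.Nullary.Decidable using (map′; ¬?; _×-dec_; _→-dec_; decidable-stable)
open import Relation.Unary using (Decidable)

open +-*-Solver
open import Algebra.Properties.CommutativeSemigroup
  (CommutativeMonoid.commutativeSemigroup ℚP.+-0-commutativeMonoid) using () renaming (interchange to +-interchange)
open import Algebra.Properties.CommutativeSemigroup
  (CommutativeMonoid.commutativeSemigroup BoolP.∧-commutativeMonoid) using () renaming (x∙yz≈y∙xz to ∧-left-comm)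
open import Algebra.Properties.Group ℚP.+-0-group using () renaming (x∙y⁻¹≈ε⇒x≈y to p-q≡0⇒p≡q)

toℚ≡mkℚ : ∀ z → toℚ z ≡ mkℚ z 0 (Coprimality.sym (Coprimality.1-coprimeTo ℤ.∣ z ∣))
toℚ≡mkℚ z = ℚP.↥p/↧p≡p (mkℚ z 0 _)

toℚᵘ-toℚ : ∀ z → ℚ.toℚᵘ (toℚ z) ≡ ℚᵘ.mkℚᵘ z 0
toℚᵘ-toℚ z = cong ℚ.toℚᵘ (toℚ≡mkℚ z)

toℚ-injective : ∀ {a b} → toℚ a ≡ toℚ b → a ≡ b
toℚ-injective {a} {b} eq = begin
  a              ≡⟨ cong ↥_ (toℚ≡mkℚ a) ⟨
  ↥ (toℚ a)      ≡⟨ cong ↥_ eq ⟩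
  ↥ (toℚ b)      ≡⟨ cong ↥_ (toℚ≡mkℚ b) ⟩
  b              ∎
  where open ≡-Reasoning

toℚ-+ : ∀ a b → toℚ (a ℤ.+ b) ≡ toℚ a + toℚ b
toℚ-+ a b = ℚP.toℚᵘ-injective (begin
  ℚ.toℚᵘ (toℚ (a ℤ.+ b))                 ≡⟨ toℚᵘ-toℚ (a ℤ.+ b) ⟩
  ℚᵘ.mkℚᵘ (a ℤ.+ b) 0                    ≈⟨ ℚᵘ.*≡* (cong₂ (λ u v → (u ℤ.+ v) ℤ.* + 1)
                                                       (sym (ℤP.*-identityʳ a)) (sym (ℤP.*-identityʳ b))) ⟩
  ℚᵘ.mkℚᵘ a 0 ℚᵘ.+ ℚᵘ.mkℚᵘ b 0           ≡⟨ cong₂ ℚᵘ._+_ (toℚᵘ-toℚ a) (toℚᵘ-toℚ b) ⟨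
  ℚ.toℚᵘ (toℚ a) ℚᵘ.+ ℚ.toℚᵘ (toℚ b)     ≈⟨ ℚP.toℚᵘ-homo-+ (toℚ a) (toℚ b) ⟨
  ℚ.toℚᵘ (toℚ a + toℚ b)                 ∎)
  where open ℚᵘP.≃-Reasoning

toℚ-* : ∀ a b → toℚ (a ℤ.* b) ≡ toℚ a * toℚ b
toℚ-* a b = ℚP.toℚᵘ-injective (begin
  ℚ.toℚᵘ (toℚ (a ℤ.* b))                 ≡⟨ toℚᵘ-toℚ (a ℤ.* b) ⟩
  ℚᵘ.mkℚᵘ a 0 ℚᵘ.* ℚᵘ.mkℚᵘ b 0           ≡⟨ cong₂ ℚᵘ._*_ (toℚᵘ-toℚ a) (toℚᵘ-toℚ b) ⟨
  ℚ.toℚᵘ (toℚ a) ℚᵘ.* ℚ.toℚᵘ (toℚ b)     ≈⟨ ℚP.toℚᵘ-homo-* (toℚ a) (toℚ b) ⟨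
  ℚ.toℚᵘ (toℚ a * toℚ b)                 ∎)
  where open ℚᵘP.≃-Reasoning

toℚ-neg : ∀ a → toℚ (ℤ.- a) ≡ - toℚ a
toℚ-neg a = ℚP.toℚᵘ-injective (begin
  ℚ.toℚᵘ (toℚ (ℤ.- a))     ≡⟨ toℚᵘ-toℚ (ℤ.- a) ⟩
  ℚᵘ.- ℚᵘ.mkℚᵘ a 0          ≡⟨ cong ℚᵘ.-_ (toℚᵘ-toℚ a) ⟨
  ℚᵘ.- ℚ.toℚᵘ (toℚ a)       ≈⟨ ℚP.toℚᵘ-homo‿- (toℚ a) ⟨
  ℚ.toℚᵘ (- toℚ a)          ∎)
  where open ℚᵘP.≃-Reasoning

toℚ-- : ∀ a b → toℚ (a ℤ.- b) ≡ toℚ a - toℚ b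
toℚ-- a b = trans (toℚ-+ a (ℤ.- b)) (cong (λ q → toℚ a + q) (toℚ-neg b))

toℚ-mono-≤ : ∀ {a b} → a ℤ.≤ b → toℚ a ≤ toℚ b
toℚ-mono-≤ {a} {b} a≤b = subst₂ _≤_ (sym (toℚ≡mkℚ a)) (sym (toℚ≡mkℚ b))
  (ℚ.*≤* (subst₂ ℤ._≤_ (sym (ℤP.*-identityʳ a)) (sym (ℤP.*-identityʳ b)) a≤b))

toℚ-cancel-≤ : ∀ {a b} → toℚ a ≤ toℚ b → a ℤ.≤ b
toℚ-cancel-≤ {a} {b} le with subst₂ _≤_ (toℚ≡mkℚ a) (toℚ≡mkℚ b) le
... | ℚ.*≤* le′ = subst₂ ℤ._≤_ (ℤP.*-identityʳ a) (ℤP.*-identityʳ b) le′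

toℚ-ℕ-mono-≤ : ∀ {m n} → m ℕ.≤ n → toℚ (+ m) ≤ toℚ (+ n)
toℚ-ℕ-mono-≤ m≤n = toℚ-mono-≤ (ℤ.+≤+ m≤n)

toℚ-ℕ-cancel-≤ : ∀ {m n} → toℚ (+ m) ≤ toℚ (+ n) → m ℕ.≤ n
toℚ-ℕ-cancel-≤ le = ℤP.drop‿+≤+ (toℚ-cancel-≤ le)

toℚ-ℕ-nonNeg : ∀ n → 0ℚ ≤ toℚ (+ n)
toℚ-ℕ-nonNeg n = toℚ-ℕ-mono-≤ {0} {n} ℕ.z≤n

toℚ-∣∣ : ∀ a → 0ℚ ≤ toℚ a → toℚ (+ ℤ.∣ a ∣) ≡ toℚ a
toℚ-∣∣ a 0≤a = cong toℚ (ℤP.0≤i⇒+∣i∣≡i (toℚ-cancel-≤ {+ 0} {a} 0≤a))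

toℚ-∣↥∣ : ∀ q → 0ℚ ≤ q → toℚ (+ ℤ.∣ ↥ q ∣) ≡ toℚ (+ ↧ₙ q) * q
toℚ-∣↥∣ (mkℚ -[1+ _ ] _ _) (ℚ.*≤* ())
toℚ-∣↥∣ q@(mkℚ (+ a) d _) _ = ℚP.toℚᵘ-injective (begin
  ℚ.toℚᵘ (toℚ (+ a))                            ≡⟨ toℚᵘ-toℚ (+ a) ⟩
  ℚᵘ.mkℚᵘ (+ a) 0                                ≈⟨ ℚᵘ.*≡* eq ⟩
  ℚᵘ.mkℚᵘ (+ suc d) 0 ℚᵘ.* ℚ.toℚᵘ q              ≡⟨ cong (ℚᵘ._* ℚ.toℚᵘ q) (toℚᵘ-toℚ (+ suc d)) ⟨
  ℚ.toℚᵘ (toℚ (+ suc d)) ℚᵘ.* ℚ.toℚᵘ q           ≈⟨ ℚP.toℚᵘ-homo-* (toℚ (+ suc d)) q ⟨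
  ℚ.toℚᵘ (toℚ (+ suc d) * q)                     ∎)
  where
  open ℚᵘP.≃-Reasoning
  eq : + a ℤ.* + (1 ℕ.* suc d) ≡ (+ suc d ℤ.* + a) ℤ.* + 1
  eq = trans (cong (λ k → + a ℤ.* + k) (ℕP.*-identityˡ (suc d)))
             (trans (ℤP.*-comm (+ a) (+ suc d)) (sym (ℤP.*-identityʳ _)))

p-q+q≡p : ∀ p q → p - q + q ≡ p
p-q+q≡p = solve 2 (λ p q → p :- q :+ q := p) refl

1≤q⇒0<q : ∀ {q} → 1ℚ ≤ q → 0ℚ < q
1≤q⇒0<q = ℚP.<-≤-trans (ℚP.positive⁻¹ 1ℚ)

0<½ : 0ℚ < ½
0<½ = ℚP.positive⁻¹ ½

½<1 : ½ < 1ℚ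
½<1 = ℚ.*<* (ℤ.+<+ (ℕ.s≤s (ℕ.s≤s ℕ.z≤n)))

p≤q⇒0≤q-p : ∀ {p q} → p ≤ q → 0ℚ ≤ q - p
p≤q⇒0≤q-p {p} {q} p≤q = subst (_≤ q - p) (ℚP.+-inverseʳ p) (ℚP.+-monoˡ-≤ (- p) p≤q)

nonNeg-+ : ∀ {p q} → 0ℚ ≤ p → 0ℚ ≤ q → 0ℚ ≤ p + q
nonNeg-+ = ℚP.+-mono-≤

nonNeg-* : ∀ {p q} → 0ℚ ≤ p → 0ℚ ≤ q → 0ℚ ≤ p * q
nonNeg-* {p} {q} 0≤p 0≤q = subst (_≤ p * q) (ℚP.*-zeroʳ p) (ℚP.*-monoˡ-≤-nonNeg p {{ℚ.nonNegative 0≤p}} 0≤q)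

nonNeg-+-zero : ∀ {p q} → 0ℚ ≤ p → 0ℚ ≤ q → p + q ≡ 0ℚ → p ≡ 0ℚ
nonNeg-+-zero {p} 0≤p 0≤q p+q≡0 =
  ℚP.≤-antisym (subst₂ _≤_ (ℚP.+-identityʳ p) p+q≡0 (ℚP.+-monoʳ-≤ p 0≤q)) 0≤p

*-cancel-zero : ∀ {p q} → p ≢ 0ℚ → p * q ≡ 0ℚ → q ≡ 0ℚ
*-cancel-zero {p} {q} p≢0 pq≡0 = begin
  q                  ≡⟨ ℚP.*-identityˡ q ⟨
  1ℚ * q             ≡⟨ cong (_* q) (ℚP.*-inverseˡ p) ⟨
  (1/ p) * p * q     ≡⟨ ℚP.*-assoc (1/ p) p q ⟩
  (1/ p) * (p * q)   ≡⟨ cong ((1/ p) *_) pq≡0 ⟩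
  (1/ p) * 0ℚ        ≡⟨ ℚP.*-zeroʳ (1/ p) ⟩
  0ℚ                 ∎
  where
  open ≡-Reasoning
  instance _ = ℚ.≢-nonZero p≢0

convex-combination-zero : ∀ {y w λ′} → 0ℚ ≤ y → 0ℚ ≤ w → 0ℚ < λ′ → λ′ < 1ℚ →
                          λ′ * y + (1ℚ - λ′) * w ≡ 0ℚ → y ≡ 0ℚ × w ≡ 0ℚ
convex-combination-zero {y} {w} {λ′} 0≤y 0≤w 0<λ λ<1 sum≡0 =
  *-cancel-zero (ℚP.<⇒≢ 0<λ ∘ sym) (nonNeg-+-zero 0≤λy 0≤μw sum≡0) ,
  *-cancel-zero (ℚP.<⇒≢ 0<μ ∘ sym)
    (nonNeg-+-zero 0≤μw 0≤λy (trans (ℚP.+-comm ((1ℚ - λ′) * w) (λ′ * y)) sum≡0))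
  where
  0<μ : 0ℚ < 1ℚ - λ′
  0<μ = subst (_< 1ℚ - λ′) (ℚP.+-inverseʳ λ′) (ℚP.+-monoˡ-< (- λ′) λ<1)
  0≤λy : 0ℚ ≤ λ′ * y
  0≤λy = nonNeg-* (ℚP.<⇒≤ 0<λ) 0≤y
  0≤μw : 0ℚ ≤ (1ℚ - λ′) * w
  0≤μw = nonNeg-* (ℚP.<⇒≤ 0<μ) 0≤w

≤∧≢⇒< : ∀ {p q} → p ≤ q → p ≢ q → p < q
≤∧≢⇒< {p} {q} p≤q p≢q with ℚP.<-cmp p q
... | tri< p<q _ _ = p<q
... | tri≈ _ p≡q _ = ⊥-elim (p≢q p≡q)
... | tri> _ _ q<p = ⊥-elim (ℚP.<-irrefl refl (ℚP.<-≤-trans q<p p≤q))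

-- A total reciprocal; the junk value recip 0ℚ = 0ℚ is never used.
recip : ℚ → ℚ
recip q with q ℚP.≟ 0ℚ
... | yes _  = 0ℚ
... | no q≢0 = (1/ q) {{ℚ.≢-nonZero q≢0}}

recip-inverseˡ : ∀ {q} → q ≢ 0ℚ → recip q * q ≡ 1ℚ
recip-inverseˡ {q} q≢0 with q ℚP.≟ 0ℚ
... | yes q≡0 = ⊥-elim (q≢0 q≡0)
... | no q≢0′ = ℚP.*-inverseˡ q {{ℚ.≢-nonZero q≢0′}}

recip-inverseʳ : ∀ p {q} → q ≢ 0ℚ → p * recip q * q ≡ p
recip-inverseʳ p {q} q≢0 =
  trans (ℚP.*-assoc p (recip q) q) (trans (cong (p *_) (recip-inverseˡ q≢0)) (ℚP.*-identityʳ p))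

recip-pos : ∀ {q} → 0ℚ < q → 0ℚ < recip q
recip-pos {q} 0<q with q ℚP.≟ 0ℚ
... | yes q≡0 = ⊥-elim (ℚP.<⇒≢ 0<q (sym q≡0))
... | no _    = ℚP.positive⁻¹ _ {{ℚP.1/pos⇒pos q {{ℚ.positive 0<q}}}}

recip-nonNeg : ∀ {q} → 0ℚ ≤ q → 0ℚ ≤ recip q
recip-nonNeg {q} 0≤q with q ℚP.≟ 0ℚ
... | yes _  = ℚP.≤-refl
... | no q≢0 =
  ℚP.<⇒≤ (ℚP.positive⁻¹ _ {{ℚP.1/pos⇒pos q {{ℚ.positive (≤∧≢⇒< 0≤q (q≢0 ∘ sym))}}}})

≤*recip⇒*≤ : ∀ {t a b} → 0ℚ < b → t ≤ a * recip b → t * b ≤ a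
≤*recip⇒*≤ {t} {a} {b} 0<b t≤a/b =
  subst (t * b ≤_) (recip-inverseʳ a (ℚP.<⇒≢ 0<b ∘ sym))
    (ℚP.*-monoʳ-≤-nonNeg b {{ℚ.nonNegative (ℚP.<⇒≤ 0<b)}} t≤a/b)

exitTime : (x c d : ℚ) → ℚ
exitTime x c d with 0ℚ ℚP.<? d
... | yes _ = (c - x) * recip d
... | no _  = x * recip (- d)

exitTime-nonNeg : ∀ {x c} d → 0ℚ ≤ x → x ≤ c → 0ℚ ≤ exitTime x c d
exitTime-nonNeg d 0≤x x≤c with 0ℚ ℚP.<? d
... | yes 0<d = nonNeg-* (p≤q⇒0≤q-p x≤c) (recip-nonNeg (ℚP.<⇒≤ 0<d))
... | no  0≮d = nonNeg-* 0≤x (recip-nonNeg (ℚP.neg-antimono-≤ (ℚP.≮⇒≥ 0≮d)))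

exitTime-inRange : ∀ {x c d t} → 0ℚ ≤ x → x ≤ c → d ≢ 0ℚ → 0ℚ ≤ t → t ≤ exitTime x c d →
                   0ℚ ≤ x + t * d × x + t * d ≤ c
exitTime-inRange {x} {c} {d} {t} 0≤x x≤c d≢0 0≤t t≤exit with 0ℚ ℚP.<? d
... | yes 0<d =
  nonNeg-+ 0≤x (nonNeg-* 0≤t (ℚP.<⇒≤ 0<d)) ,
  subst (x + t * d ≤_) (x+[c-x]≡c x c) (ℚP.+-monoʳ-≤ x (≤*recip⇒*≤ 0<d t≤exit))
  where
  x+[c-x]≡c : ∀ x c → x + (c - x) ≡ c
  x+[c-x]≡c = solve 2 (λ x c → x :+ (c :- x) := c) refl
... | no  0≮d =
  subst (0ℚ ≤_) (x-t*[-d]≡x+t*d x t d) (p≤q⇒0≤q-p {t * - d} {x} (≤*recip⇒*≤ 0<-d t≤exit)) ,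
  ℚP.≤-trans (subst (x + t * d ≤_) (ℚP.+-identityʳ x) (ℚP.+-monoʳ-≤ x t*d≤0)) x≤c
  where
  d≤0 : d ≤ 0ℚ
  d≤0 = ℚP.≮⇒≥ 0≮d
  0<-d : 0ℚ < - d
  0<-d = ℚP.neg-antimono-< (≤∧≢⇒< d≤0 d≢0)
  t*d≤0 : t * d ≤ 0ℚ
  t*d≤0 = subst (t * d ≤_) (ℚP.*-zeroʳ t) (ℚP.*-monoˡ-≤-nonNeg t {{ℚ.nonNegative 0≤t}} d≤0)
  x-t*[-d]≡x+t*d : ∀ x t d → x - t * (- d) ≡ x + t * d
  x-t*[-d]≡x+t*d = solve 3 (λ x t d → x :- t :* (:- d) := x :+ t :* d) refl

exitTime-onBoundary : ∀ x c {d} → d ≢ 0ℚ → x + exitTime x c d * d ≡ c ⊎ x + exitTime x c d * d ≡ 0ℚ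
exitTime-onBoundary x c {d} d≢0 with 0ℚ ℚP.<? d
... | yes _ = inj₁ (trans (cong (λ q → x + q) (recip-inverseʳ (c - x) d≢0)) (x+[c-x]≡c x c))
  where
  x+[c-x]≡c : ∀ x c → x + (c - x) ≡ c
  x+[c-x]≡c = solve 2 (λ x c → x :+ (c :- x) := c) refl
... | no  _ = inj₂ (begin
  x + x * recip (- d) * d           ≡⟨ cong (λ q → x + q) (a*d≡-[a*-d] (x * recip (- d)) d) ⟩
  x + - (x * recip (- d) * (- d))   ≡⟨ cong (λ q → x + - q) (recip-inverseʳ x (d≢0 ∘ ℚP.neg-injective)) ⟩
  x + - x                           ≡⟨ ℚP.+-inverseʳ x ⟩
  0ℚ                                ∎)
  where
  open ≡-Reasoning
  a*d≡-[a*-d] : ∀ a d → a * d ≡ - (a * (- d))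
  a*d≡-[a*-d] = solve 2 (λ a d → a :* d := :- (a :* (:- d))) refl

recip-≤1 : ∀ {q} → 1ℚ ≤ q → recip q ≤ 1ℚ
recip-≤1 {q} 1≤q = subst₂ _≤_ (ℚP.*-identityʳ (recip q)) (recip-inverseˡ (ℚP.<⇒≢ 0<q ∘ sym))
                     (ℚP.*-monoˡ-≤-nonNeg (recip q) {{ℚ.nonNegative (ℚP.<⇒≤ (recip-pos 0<q))}} 1≤q)
  where
  0<q : 0ℚ < q
  0<q = 1≤q⇒0<q 1≤q

recip-*-≤ : ∀ {q p r} → 1ℚ ≤ q → p ≤ q * r → recip q * p ≤ r
recip-*-≤ {q} {p} {r} 1≤q p≤qr = subst (recip q * p ≤_) recip*q*r≡r
  (ℚP.*-monoˡ-≤-nonNeg (recip q) {{ℚ.nonNegative (ℚP.<⇒≤ (recip-pos 0<q))}} p≤qr)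
  where
  0<q : 0ℚ < q
  0<q = 1≤q⇒0<q 1≤q
  recip*q*r≡r : recip q * (q * r) ≡ r
  recip*q*r≡r = trans (sym (ℚP.*-assoc (recip q) q r))
                  (trans (cong (_* r) (recip-inverseˡ (ℚP.<⇒≢ 0<q ∘ sym))) (ℚP.*-identityˡ r))

sumℚ-cong : ∀ m {f g : Column m → ℚ} → f ≗ g → sumℚ m f ≡ sumℚ m g
sumℚ-cong zero    f≗g = f≗g []
sumℚ-cong (suc m) f≗g = cong₂ _+_ (sumℚ-cong m (f≗g ∘ (true ∷_))) (sumℚ-cong m (f≗g ∘ (false ∷_)))

sumℚ-zero : ∀ m {f : Column m → ℚ} → (∀ i → f i ≡ 0ℚ) → sumℚ m f ≡ 0ℚ
sumℚ-zero zero    f≡0 = f≡0 []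
sumℚ-zero (suc m) f≡0 = cong₂ _+_ (sumℚ-zero m (f≡0 ∘ (true ∷_))) (sumℚ-zero m (f≡0 ∘ (false ∷_)))

sumℚ-+ : ∀ m (f g : Column m → ℚ) → sumℚ m (λ i → f i + g i) ≡ sumℚ m f + sumℚ m g
sumℚ-+ zero    f g = refl
sumℚ-+ (suc m) f g = trans
  (cong₂ _+_ (sumℚ-+ m (f ∘ (true ∷_)) (g ∘ (true ∷_))) (sumℚ-+ m (f ∘ (false ∷_)) (g ∘ (false ∷_))))
  (+-interchange (sumℚ m (f ∘ (true ∷_))) (sumℚ m (g ∘ (true ∷_)))
                 (sumℚ m (f ∘ (false ∷_))) (sumℚ m (g ∘ (false ∷_))))

sumℚ-* : ∀ m k (f : Column m → ℚ) → sumℚ m (λ i → k * f i) ≡ k * sumℚ m f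
sumℚ-* zero    k f = refl
sumℚ-* (suc m) k f = trans (cong₂ _+_ (sumℚ-* m k (f ∘ (true ∷_))) (sumℚ-* m k (f ∘ (false ∷_))))
                           (sym (ℚP.*-distribˡ-+ k (sumℚ m (f ∘ (true ∷_))) (sumℚ m (f ∘ (false ∷_)))))

sumℚ-neg : ∀ m (f : Column m → ℚ) → sumℚ m (λ i → - f i) ≡ - sumℚ m f
sumℚ-neg zero    f = refl
sumℚ-neg (suc m) f = trans (cong₂ _+_ (sumℚ-neg m (f ∘ (true ∷_))) (sumℚ-neg m (f ∘ (false ∷_))))
                           (sym (ℚP.neg-distrib-+ (sumℚ m (f ∘ (true ∷_))) (sumℚ m (f ∘ (false ∷_)))))

sumℚ-last : ∀ m (f : Column (suc m) → ℚ) →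
            sumℚ (suc m) f ≡ sumℚ m (λ i → f (i ∷ʳ true)) + sumℚ m (λ i → f (i ∷ʳ false))
sumℚ-last zero    f = refl
sumℚ-last (suc m) f = trans
  (cong₂ _+_ (sumℚ-last m (f ∘ (true ∷_))) (sumℚ-last m (f ∘ (false ∷_))))
  (+-interchange (sumℚ m (λ i → f (true ∷ (i ∷ʳ true)))) (sumℚ m (λ i → f (true ∷ (i ∷ʳ false))))
                 (sumℚ m (λ i → f (false ∷ (i ∷ʳ true)))) (sumℚ m (λ i → f (false ∷ (i ∷ʳ false)))))

toℚ-sumℤ : ∀ m (f : Column m → ℤ) → toℚ (sumℤ m f) ≡ sumℚ m (toℚ ∘ f)
toℚ-sumℤ zero    f = refl
toℚ-sumℤ (suc m) f = trans (toℚ-+ (sumℤ m (f ∘ (true ∷_))) (sumℤ m (f ∘ (false ∷_))))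
                           (cong₂ _+_ (toℚ-sumℤ m (f ∘ (true ∷_))) (toℚ-sumℤ m (f ∘ (false ∷_))))

sumℤ-cong : ∀ m {f g : Column m → ℤ} → f ≗ g → sumℤ m f ≡ sumℤ m g
sumℤ-cong zero    f≗g = f≗g []
sumℤ-cong (suc m) f≗g = cong₂ ℤ._+_ (sumℤ-cong m (f≗g ∘ (true ∷_))) (sumℤ-cong m (f≗g ∘ (false ∷_)))

sumℕ : ∀ m → (Column m → ℕ) → ℕ
sumℕ zero    f = f []
sumℕ (suc m) f = sumℕ m (f ∘ (true ∷_)) ℕ.+ sumℕ m (f ∘ (false ∷_))

sumℕ-≥ : ∀ m (f : Column m → ℕ) i → f i ℕ.≤ sumℕ m f
sumℕ-≥ zero    f []          = ℕP.≤-refl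
sumℕ-≥ (suc m) f (true ∷ i)  = ℕP.≤-trans (sumℕ-≥ m (f ∘ (true ∷_)) i) (ℕP.m≤m+n _ _)
sumℕ-≥ (suc m) f (false ∷ i) = ℕP.≤-trans (sumℕ-≥ m (f ∘ (false ∷_)) i) (ℕP.m≤n+m _ _)

sumℕ-mono-≤ : ∀ m {f g : Column m → ℕ} → (∀ i → f i ℕ.≤ g i) → sumℕ m f ℕ.≤ sumℕ m g
sumℕ-mono-≤ zero    f≤g = f≤g []
sumℕ-mono-≤ (suc m) f≤g =
  ℕP.+-mono-≤ (sumℕ-mono-≤ m (f≤g ∘ (true ∷_))) (sumℕ-mono-≤ m (f≤g ∘ (false ∷_)))

sumℕ-mono-< : ∀ m {f g : Column m → ℕ} → (∀ i → f i ℕ.≤ g i) → ∀ j → f j ℕ.< g j →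
              sumℕ m f ℕ.< sumℕ m g
sumℕ-mono-< zero    f≤g []          fj<gj = fj<gj
sumℕ-mono-< (suc m) f≤g (true ∷ j)  fj<gj =
  ℕP.+-mono-<-≤ (sumℕ-mono-< m (f≤g ∘ (true ∷_)) j fj<gj) (sumℕ-mono-≤ m (f≤g ∘ (false ∷_)))
sumℕ-mono-< (suc m) f≤g (false ∷ j) fj<gj =
  ℕP.+-mono-≤-< (sumℕ-mono-≤ m (f≤g ∘ (true ∷_))) (sumℕ-mono-< m (f≤g ∘ (false ∷_)) j fj<gj)

χ : ∀ {P : Set} → Dec P → ℕ
χ (yes _) = 1
χ (no _)  = 0

χ-mono-≤ : ∀ {P Q : Set} → (P → Q) → (P? : Dec P) (Q? : Dec Q) → χ P? ℕ.≤ χ Q?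
χ-mono-≤ P⇒Q (yes p) (yes _) = ℕP.≤-refl
χ-mono-≤ P⇒Q (yes p) (no ¬q) = ⊥-elim (¬q (P⇒Q p))
χ-mono-≤ P⇒Q (no _)  _       = ℕ.z≤n

χ-mono-< : ∀ {P Q : Set} → ¬ P → Q → (P? : Dec P) (Q? : Dec Q) → χ P? ℕ.< χ Q?
χ-mono-< ¬p q (yes p) _      = ⊥-elim (¬p p)
χ-mono-< ¬p q (no _) (yes _) = ℕP.≤-refl
χ-mono-< ¬p q (no _) (no ¬q) = ⊥-elim (¬q q)

anyBelow? : ∀ m (c : Column m → ℕ) {P : (Column m → ℕ) → Set} →
            (∀ u → Dec (P u)) → (∀ {u v} → u ≗ v → P u → P v) →
            Dec (∃[ u ] (∀ i → u i ℕ.≤ c i) × P u)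
anyBelow? zero c {P} P? resp = map′
  (λ (k , k<1+c , Pk) → (λ _ → k) , (λ { [] → ℕ.s≤s⁻¹ k<1+c }) , Pk)
  (λ (u , u≤c , Pu) → u [] , ℕ.s≤s (u≤c []) , resp (λ { [] → refl }) Pu)
  (ℕP.anyUpTo? (λ k → P? (λ _ → k)) (suc (c [])))
anyBelow? (suc m) c {P} P? resp = map′
  (λ (u₁ , u₁≤c , u₂ , u₂≤c , Pu) → join u₁ u₂ , join-≤ u₁≤c u₂≤c , Pu)
  (λ (u , u≤c , Pu) →
     u ∘ (true ∷_) , u≤c ∘ (true ∷_) , u ∘ (false ∷_) , u≤c ∘ (false ∷_) , resp join-split Pu)
  (anyBelow? m (c ∘ (true ∷_)) Q?
     (λ u₁≗v₁ (u₂ , u₂≤c , Pu) → u₂ , u₂≤c , resp (join-congˡ u₁≗v₁) Pu))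
  where
  join : (Column m → ℕ) → (Column m → ℕ) → Column (suc m) → ℕ
  join u₁ u₂ (true ∷ i)  = u₁ i
  join u₁ u₂ (false ∷ i) = u₂ i
  join-≤ : ∀ {u₁ u₂} → (∀ i → u₁ i ℕ.≤ c (true ∷ i)) → (∀ i → u₂ i ℕ.≤ c (false ∷ i)) →
           ∀ i → join u₁ u₂ i ℕ.≤ c i
  join-≤ u₁≤c u₂≤c (true ∷ i)  = u₁≤c i
  join-≤ u₁≤c u₂≤c (false ∷ i) = u₂≤c i
  join-split : ∀ {u} → u ≗ join (u ∘ (true ∷_)) (u ∘ (false ∷_))
  join-split (true ∷ i)  = refl
  join-split (false ∷ i) = refl
  join-congˡ : ∀ {u₁ v₁ u₂} → u₁ ≗ v₁ → join u₁ u₂ ≗ join v₁ u₂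
  join-congˡ u₁≗v₁ (true ∷ i)  = u₁≗v₁ i
  join-congˡ u₁≗v₁ (false ∷ i) = refl
  Q? : ∀ u₁ → Dec (∃[ u₂ ] (∀ i → u₂ i ℕ.≤ c (false ∷ i)) × P (join u₁ u₂))
  Q? u₁ = anyBelow? m (c ∘ (false ∷_)) (λ u₂ → P? (join u₁ u₂)) (λ u₂≗v₂ → resp (join-congʳ u₂≗v₂))
    where
    join-congʳ : ∀ {u₂ v₂} → u₂ ≗ v₂ → join u₁ u₂ ≗ join u₁ v₂
    join-congʳ u₂≗v₂ (true ∷ i)  = refl
    join-congʳ u₂≗v₂ (false ∷ i) = u₂≗v₂ i

allSubsets? : ∀ {n} {P : Subset n → Set} → Decidable P → Dec (∀ F → P F)
allSubsets? P? = map′ (λ ¬∃¬P F → decidable-stable (P? F) (λ ¬PF → ¬∃¬P (F , ¬PF)))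
                      (λ ∀P (F , ¬PF) → ¬PF (∀P F))
                      (¬? (anySubset? (¬? ∘ P?)))

argmin : ∀ m {P : Column m → Set} → Decidable P → (f : Column m → ℚ) →
         (∀ j → ¬ P j) ⊎ (∃[ j ] P j × (∀ i → P i → f j ≤ f i))
argmin zero {P} P? f with P? []
... | yes p = inj₂ ([] , p , λ { [] _ → ℚP.≤-refl })
... | no ¬p = inj₁ λ { [] → ¬p }
argmin (suc m) P? f with argmin m (P? ∘ (true ∷_)) (f ∘ (true ∷_)) | argmin m (P? ∘ (false ∷_)) (f ∘ (false ∷_))
... | inj₁ none₁ | inj₁ none₂ = inj₁ λ { (true ∷ i) → none₁ i ; (false ∷ i) → none₂ i }
... | inj₂ (j₁ , p₁ , min₁) | inj₁ none₂ =
  inj₂ (true ∷ j₁ , p₁ , λ { (true ∷ i) → min₁ i ; (false ∷ i) p → ⊥-elim (none₂ i p) })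
... | inj₁ none₁ | inj₂ (j₂ , p₂ , min₂) =
  inj₂ (false ∷ j₂ , p₂ , λ { (true ∷ i) p → ⊥-elim (none₁ i p) ; (false ∷ i) → min₂ i })
... | inj₂ (j₁ , p₁ , min₁) | inj₂ (j₂ , p₂ , min₂) with ℚP.≤-total (f (true ∷ j₁)) (f (false ∷ j₂))
...   | inj₁ f₁≤f₂ =
  inj₂ (true ∷ j₁ , p₁ , λ { (true ∷ i) → min₁ i ; (false ∷ i) p → ℚP.≤-trans f₁≤f₂ (min₂ i p) })
...   | inj₂ f₂≤f₁ =
  inj₂ (false ∷ j₂ , p₂ , λ { (true ∷ i) p → ℚP.≤-trans f₂≤f₁ (min₁ i p) ; (false ∷ i) → min₂ i })

Represents : ∀ {R m} → Matrix R m → R → ((Column m → ℚ) → ℚ) → Set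
Represents A r φ = ∀ x → (A ·ℚ x) r ≡ φ x

module _ {R : Set} {m : ℕ} (A : Matrix R m) where

  ·ℚ-cong : ∀ {x y} → x ≗ y → ∀ r → (A ·ℚ x) r ≡ (A ·ℚ y) r
  ·ℚ-cong x≗y r = sumℚ-cong m (λ i → cong (toℚ (A r i) *_) (x≗y i))

  ·ℤ-cong : ∀ {z z′} → z ≗ z′ → ∀ r → (A ·ℤ z) r ≡ (A ·ℤ z′) r
  ·ℤ-cong z≗z′ r = sumℤ-cong m (λ i → cong (A r i ℤ.*_) (z≗z′ i))

  ·ℚ-+ : ∀ x y r → (A ·ℚ (λ i → x i + y i)) r ≡ (A ·ℚ x) r + (A ·ℚ y) r
  ·ℚ-+ x y r = trans (sumℚ-cong m (λ i → ℚP.*-distribˡ-+ (toℚ (A r i)) (x i) (y i)))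
                     (sumℚ-+ m (λ i → toℚ (A r i) * x i) (λ i → toℚ (A r i) * y i))

  ·ℚ-* : ∀ k x r → (A ·ℚ (λ i → k * x i)) r ≡ k * (A ·ℚ x) r
  ·ℚ-* k x r = trans (sumℚ-cong m (λ i → swap (toℚ (A r i)) k (x i)))
                     (sumℚ-* m k (λ i → toℚ (A r i) * x i))
    where
    swap : ∀ a k x → a * (k * x) ≡ k * (a * x)
    swap = solve 3 (λ a k x → a :* (k :* x) := k :* (a :* x)) refl

  ·ℚ-- : ∀ x y r → (A ·ℚ (λ i → x i - y i)) r ≡ (A ·ℚ x) r - (A ·ℚ y) r
  ·ℚ-- x y r = begin
    (A ·ℚ (λ i → x i - y i)) r              ≡⟨ ·ℚ-+ x (λ i → - y i) r ⟩
    (A ·ℚ x) r + (A ·ℚ (λ i → - y i)) r      ≡⟨ cong (λ q → (A ·ℚ x) r + q) neg ⟩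
    (A ·ℚ x) r - (A ·ℚ y) r                  ∎
    where
    open ≡-Reasoning
    neg : (A ·ℚ (λ i → - y i)) r ≡ - (A ·ℚ y) r
    neg = trans (sumℚ-cong m (λ i → sym (ℚP.neg-distribʳ-* (toℚ (A r i)) (y i))))
                (sumℚ-neg m (λ i → toℚ (A r i) * y i))

  ·ℚ-move : ∀ x t d r → (A ·ℚ (λ i → x i + t * d i)) r ≡ (A ·ℚ x) r + t * (A ·ℚ d) r
  ·ℚ-move x t d r = trans (·ℚ-+ x (λ i → t * d i) r) (cong (λ q → (A ·ℚ x) r + q) (·ℚ-* t d r))

  toℚ-·ℤ : ∀ z r → toℚ ((A ·ℤ z) r) ≡ (A ·ℚ (toℚ ∘ z)) r
  toℚ-·ℤ z r = trans (toℚ-sumℤ m (λ i → A r i ℤ.* z i)) (sumℚ-cong m (λ i → toℚ-* (A r i) (z i)))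

  ·ℤ-from-·ℚ : ∀ z {b r} → (A ·ℚ (toℚ ∘ z)) r ≡ toℚ b → (A ·ℤ z) r ≡ b
  ·ℤ-from-·ℚ z {b} {r} eq = toℚ-injective (trans (toℚ-·ℤ z r) eq)

  semigroup⊆cone∩lattice : ∀ b → InSemigroup A b → InCone A b × InLattice A b
  semigroup⊆cone∩lattice b (u , Au≡b) =
    (toℚ ∘ +_ ∘ u , toℚ-ℕ-nonNeg ∘ u , λ r → trans (sym (toℚ-·ℤ (+_ ∘ u) r)) (cong toℚ (Au≡b r))) ,
    (+_ ∘ u , Au≡b)

  CoordinateRows : Set
  CoordinateRows = ∀ i → Σ[ r ∈ R ] Represents A r (λ x → x i)

  coordinateRows⇒unimodular : CoordinateRows → IsUnimodular A
  coordinateRows⇒unimodular rows b _ _ x ((_ , Ax≡b) , _) i =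
    let r , Ar≡xi = rows i in b r , trans (sym (Ar≡xi x)) (Ax≡b r)

  coordinateRows⇒normal : CoordinateRows → IsNormal A
  coordinateRows⇒normal rows b = cone∩lattice⊆semigroup , semigroup⊆cone∩lattice b
    where
    cone∩lattice⊆semigroup : InCone A b × InLattice A b → InSemigroup A b
    cone∩lattice⊆semigroup ((x , x≥0 , Ax≡b) , (z , Az≡b)) =
      ℤ.∣_∣ ∘ z , λ r → trans (·ℤ-cong ∣z∣≡z r) (Az≡b r)
      where
      x≡z : ∀ i → x i ≡ toℚ (z i)
      x≡z i = let r , Ar≡· = rows i in begin
        x i                     ≡⟨ Ar≡· x ⟨
        (A ·ℚ x) r              ≡⟨ Ax≡b r ⟩
        toℚ (b r)               ≡⟨ cong toℚ (Az≡b r) ⟨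
        toℚ ((A ·ℤ z) r)        ≡⟨ toℚ-·ℤ z r ⟩
        (A ·ℚ (toℚ ∘ z)) r      ≡⟨ Ar≡· (toℚ ∘ z) ⟩
        toℚ (z i)               ∎
        where open ≡-Reasoning
      ∣z∣≡z : ∀ i → + ℤ.∣ z i ∣ ≡ z i
      ∣z∣≡z i = toℚ-injective (toℚ-∣∣ (z i) (subst (0ℚ ≤_) (x≡z i) (x≥0 i)))

-- x is the midpoint of x ± s (y − x), which lie in the polyhedron once s ≤ 1 / κ.
vertex-≡-dominated : ∀ {R m} {A : Matrix R m} {b x y} → IsVertex A b x → InPolyhedron A b y →
                     ∀ {κ} → 1ℚ ≤ κ → (∀ i → y i ≤ κ * x i) → x ≗ y
vertex-≡-dominated {A = A} {b} {x} {y} ((0≤x , Ax≡b) , vertex) (0≤y , Ay≡b) {κ} 1≤κ y≤κx i =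
  sym (p-q≡0⇒p≡q (y i) (x i) (*-cancel-zero 2s≢0 (begin
    (s + s) * (y i - x i)   ≡⟨ w₊-w₋ (x i) s (y i) ⟨
    w₊ i - w₋ i             ≡⟨ cong (_- w₋ i) (sym w₋≡w₊) ⟩
    w₋ i - w₋ i             ≡⟨ ℚP.+-inverseʳ (w₋ i) ⟩
    0ℚ                      ∎)))
  where
  open ≡-Reasoning
  s : ℚ
  s = recip κ
  0<s : 0ℚ < s
  0<s = recip-pos (1≤q⇒0<q 1≤κ)
  w₋ w₊ : Column _ → ℚ
  w₋ j = x j + (- s) * (y j - x j)
  w₊ j = x j + s * (y j - x j)
  on-fibre : ∀ t r → (A ·ℚ (λ j → x j + t * (y j - x j))) r ≡ toℚ (b r)
  on-fibre t r = begin
    (A ·ℚ (λ j → x j + t * (y j - x j))) r          ≡⟨ ·ℚ-move A x t (λ j → y j - x j) r ⟩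
    (A ·ℚ x) r + t * (A ·ℚ (λ j → y j - x j)) r      ≡⟨ cong (λ q → (A ·ℚ x) r + t * q) (·ℚ-- A y x r) ⟩
    (A ·ℚ x) r + t * ((A ·ℚ y) r - (A ·ℚ x) r)       ≡⟨ cong₂ (λ p q → p + t * (q - p)) (Ax≡b r) (Ay≡b r) ⟩
    toℚ (b r) + t * (toℚ (b r) - toℚ (b r))          ≡⟨ p+t*[p-p]≡p (toℚ (b r)) t ⟩
    toℚ (b r)                                        ∎
    where
    p+t*[p-p]≡p : ∀ p t → p + t * (p - p) ≡ p
    p+t*[p-p]≡p = solve 2 (λ p t → p :+ t :* (p :- p) := p) refl
  0≤w₋ : ∀ j → 0ℚ ≤ w₋ j
  0≤w₋ j = subst (0ℚ ≤_) (sym (w₋≡ (x j) s (y j)))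
             (nonNeg-+ (p≤q⇒0≤q-p (recip-*-≤ 1≤κ (y≤κx j))) (nonNeg-* (ℚP.<⇒≤ 0<s) (0≤x j)))
    where
    w₋≡ : ∀ x s y → x + (- s) * (y - x) ≡ (x - s * y) + s * x
    w₋≡ = solve 3 (λ x s y → x :+ (:- s) :* (y :- x) := (x :- s :* y) :+ s :* x) refl
  0≤w₊ : ∀ j → 0ℚ ≤ w₊ j
  0≤w₊ j = subst (0ℚ ≤_) (sym (w₊≡ (x j) s (y j)))
             (nonNeg-+ (nonNeg-* (p≤q⇒0≤q-p (recip-≤1 1≤κ)) (0≤x j)) (nonNeg-* (ℚP.<⇒≤ 0<s) (0≤y j)))
    where
    w₊≡ : ∀ x s y → x + s * (y - x) ≡ (1ℚ - s) * x + s * y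
    w₊≡ = solve 3 (λ x s y → x :+ s :* (y :- x) := (con 1ℚ :- s) :* x :+ s :* y) refl
  x≡midpoint : ∀ j → x j ≡ ½ * w₋ j + (1ℚ - ½) * w₊ j
  x≡midpoint j = midpoint (x j) s (y j)
    where
    midpoint : ∀ x s y → x ≡ ½ * (x + (- s) * (y - x)) + (1ℚ - ½) * (x + s * (y - x))
    midpoint = solve 3 (λ x s y →
      x := con ½ :* (x :+ (:- s) :* (y :- x)) :+ (con 1ℚ :- con ½) :* (x :+ s :* (y :- x))) refl
  w₋≡w₊ : w₋ i ≡ w₊ i
  w₋≡w₊ = vertex w₋ w₊ ½ (0≤w₋ , on-fibre (- s)) (0≤w₊ , on-fibre s) 0<½ ½<1 x≡midpoint i
  w₊-w₋ : ∀ x s y → (x + s * (y - x)) - (x + (- s) * (y - x)) ≡ (s + s) * (y - x)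
  w₊-w₋ = solve 3 (λ x s y → (x :+ s :* (y :- x)) :- (x :+ (:- s) :* (y :- x)) := (s :+ s) :* (y :- x)) refl
  2s≢0 : s + s ≢ 0ℚ
  2s≢0 = ℚP.<⇒≢ (ℚP.+-mono-< 0<s 0<s) ∘ sym

-- Integral points in boxes

BoxSolution : ∀ {R m} → Matrix R m → (Column m → ℕ) → (Column m → ℤ) → (Column m → ℚ) → Set
BoxSolution A c z x = (∀ i → 0ℚ ≤ x i) × (∀ i → x i ≤ toℚ (+ c i)) × (A ·ℚ x ≗ A ·ℚ (toℚ ∘ z))

IntegralBoxSolution : ∀ {R m} → Matrix R m → (Column m → ℕ) → (Column m → ℤ) → Set
IntegralBoxSolution A c z = ∃[ u ] (∀ i → u i ℕ.≤ c i) × (A ·ℕ u ≗ A ·ℤ z)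

IsBoxIntegral : ∀ {R m} → Matrix R m → Set
IsBoxIntegral {m = m} A = ∀ c z (x : Column m → ℚ) → BoxSolution A c z x → IntegralBoxSolution A c z

isBoxIntegral⇒unimodular : ∀ {R m} (A : Matrix R m) → IsBoxIntegral A → IsUnimodular A
isBoxIntegral⇒unimodular {m = m} A boxIntegral b (z , Az≡b) _ x vertex@((0≤x , Ax≡b) , _) i =
  + u i , vertex-≡-dominated {A = A} {b} {x} {toℚ ∘ +_ ∘ u} vertex (toℚ-ℕ-nonNeg ∘ u , Au≡b) 1≤κ u≤κx i
  where
  -- c i is the numerator of x i, so c i = (denominator of x i) * x i ≤ κ * x i.
  den c : Column m → ℕ
  den i = ↧ₙ (x i)
  c i = ℤ.∣ ↥ (x i) ∣
  κ : ℚ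
  κ = toℚ (+ suc (sumℕ m den))
  1≤κ : 1ℚ ≤ κ
  1≤κ = toℚ-ℕ-mono-≤ {1} {suc (sumℕ m den)} (ℕ.s≤s ℕ.z≤n)
  c≡den*x : ∀ i → toℚ (+ c i) ≡ toℚ (+ den i) * x i
  c≡den*x i = toℚ-∣↥∣ (x i) (0≤x i)
  x≤c : ∀ i → x i ≤ toℚ (+ c i)
  x≤c i = subst₂ _≤_ (ℚP.*-identityˡ (x i)) (sym (c≡den*x i))
            (ℚP.*-monoʳ-≤-nonNeg (x i) {{ℚ.nonNegative (0≤x i)}} (toℚ-ℕ-mono-≤ {1} {den i} (ℕ.s≤s ℕ.z≤n)))
  integral : IntegralBoxSolution A c z
  integral = boxIntegral c z x (0≤x , x≤c , λ r → trans (Ax≡b r) (trans (cong toℚ (sym (Az≡b r))) (toℚ-·ℤ A z r)))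
  u : Column m → ℕ
  u = proj₁ integral
  Au≡b : A ·ℚ (toℚ ∘ +_ ∘ u) ≗ toℚ ∘ b
  Au≡b r = trans (sym (toℚ-·ℤ A (+_ ∘ u) r)) (cong toℚ (trans (proj₂ (proj₂ integral) r) (Az≡b r)))
  u≤κx : ∀ i → toℚ (+ u i) ≤ κ * x i
  u≤κx i = ℚP.≤-trans (toℚ-ℕ-mono-≤ (proj₁ (proj₂ integral) i))
             (subst (_≤ κ * x i) (sym (c≡den*x i))
               (ℚP.*-monoʳ-≤-nonNeg (x i) {{ℚ.nonNegative (0≤x i)}}
                 (toℚ-ℕ-mono-≤ (ℕP.≤-trans (sumℕ-≥ m den i) (ℕP.n≤1+n _)))))

DecidableFibres : ∀ {R m} → Matrix R m → Set
DecidableFibres {m = m} A = ∀ (u v : Column m → ℤ) → Dec (A ·ℤ u ≗ A ·ℤ v)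

module BoxSolutions {R : Set} {m : ℕ} (A : Matrix R m) (c : Column m → ℕ) (z : Column m → ℤ) where

  cq : Column m → ℚ
  cq i = toℚ (+ c i)

  Interior : (Column m → ℚ) → Column m → Set
  Interior x j = 0ℚ < x j × x j < cq j

  interior? : ∀ x j → Dec (Interior x j)
  interior? x j = (0ℚ ℚP.<? x j) ×-dec (x j ℚP.<? cq j)

  interiorCount : (Column m → ℚ) → ℕ
  interiorCount x = sumℕ m (λ j → χ (interior? x j))

  push-to-boundary : ∀ {x} → BoxSolution A c z x → (d : Column m → ℚ) → (∀ r → (A ·ℚ d) r ≡ 0ℚ) →
                     (∀ j → d j ≢ 0ℚ → Interior x j) → ∀ i → d i ≢ 0ℚ →
                     ∃[ x′ ] BoxSolution A c z x′ × interiorCount x′ ℕ.< interiorCount x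
  push-to-boundary {x} (0≤x , x≤c , Ax≡Az) d Ad≡0 support i di≢0
    with argmin m (λ j → ¬? (d j ℚP.≟ 0ℚ)) (λ j → exitTime (x j) (cq j) (d j))
  ... | inj₁ d≡0 = ⊥-elim (d≡0 i di≢0)
  ... | inj₂ (k , dk≢0 , k-first) =
    x′ , (proj₁ ∘ inRange , proj₂ ∘ inRange , Ax′≡Az) ,
    sumℕ-mono-< m (λ j → χ-mono-≤ (interior-shrinks j) _ _) k (χ-mono-< k-leaves (support k dk≢0) _ _)
    where
    t : ℚ
    t = exitTime (x k) (cq k) (d k)
    x′ : Column m → ℚ
    x′ j = x j + t * d j
    x′≡x : ∀ j → d j ≡ 0ℚ → x′ j ≡ x j
    x′≡x j dj≡0 = trans (cong (λ q → x j + t * q) dj≡0)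
                        (trans (cong (λ q → x j + q) (ℚP.*-zeroʳ t)) (ℚP.+-identityʳ (x j)))
    inRange : ∀ j → 0ℚ ≤ x′ j × x′ j ≤ cq j
    inRange j with d j ℚP.≟ 0ℚ
    ... | yes dj≡0 = subst (λ q → 0ℚ ≤ q × q ≤ cq j) (sym (x′≡x j dj≡0)) (0≤x j , x≤c j)
    ... | no  dj≢0 =
      exitTime-inRange (0≤x j) (x≤c j) dj≢0 (exitTime-nonNeg (d k) (0≤x k) (x≤c k)) (k-first j dj≢0)
    Ax′≡Az : A ·ℚ x′ ≗ A ·ℚ (toℚ ∘ z)
    Ax′≡Az r = begin
      (A ·ℚ x′) r                  ≡⟨ ·ℚ-move A x t d r ⟩
      (A ·ℚ x) r + t * (A ·ℚ d) r   ≡⟨ cong (λ q → (A ·ℚ x) r + t * q) (Ad≡0 r) ⟩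
      (A ·ℚ x) r + t * 0ℚ           ≡⟨ cong (λ q → (A ·ℚ x) r + q) (ℚP.*-zeroʳ t) ⟩
      (A ·ℚ x) r + 0ℚ               ≡⟨ ℚP.+-identityʳ _ ⟩
      (A ·ℚ x) r                    ≡⟨ Ax≡Az r ⟩
      (A ·ℚ (toℚ ∘ z)) r            ∎
      where open ≡-Reasoning
    interior-shrinks : ∀ j → Interior x′ j → Interior x j
    interior-shrinks j with d j ℚP.≟ 0ℚ
    ... | yes dj≡0 = subst (λ q → 0ℚ < q × q < cq j) (x′≡x j dj≡0)
    ... | no  dj≢0 = λ _ → support j dj≢0
    k-leaves : ¬ Interior x′ k
    k-leaves (0<x′k , x′k<c) with exitTime-onBoundary (x k) (cq k) dk≢0
    ... | inj₁ x′k≡c = ℚP.<-irrefl x′k≡c x′k<c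
    ... | inj₂ x′k≡0 = ℚP.<-irrefl (sym x′k≡0) 0<x′k

  module Lowering {x} (sol : BoxSolution A c z x) where

    0≤x : ∀ i → 0ℚ ≤ x i
    0≤x = proj₁ sol

    x≤c : ∀ i → x i ≤ cq i
    x≤c = proj₁ (proj₂ sol)

    topPart : Column m → ℤ
    topPart j with x j ℚP.≟ cq j
    ... | yes _ = + c j
    ... | no  _ = + 0

    lowered : Column m → ℚ
    lowered j = x j - toℚ (topPart j)

    b′ : R → ℤ
    b′ = A ·ℤ (λ j → z j ℤ.- topPart j)

    lowered-nonNeg : ∀ j → 0ℚ ≤ lowered j
    lowered-nonNeg j with x j ℚP.≟ cq j
    ... | yes xj≡c = ℚP.≤-reflexive (sym (trans (cong (_- cq j) xj≡c) (ℚP.+-inverseʳ (cq j))))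
    ... | no  _    = subst (0ℚ ≤_) (sym (ℚP.+-identityʳ (x j))) (0≤x j)

    lowered-support : ∀ j → lowered j ≢ 0ℚ → Interior x j
    lowered-support j lj≢0 with x j ℚP.≟ cq j
    ... | yes xj≡c = ⊥-elim (lj≢0 (trans (cong (_- cq j) xj≡c) (ℚP.+-inverseʳ (cq j))))
    ... | no  xj≢c =
      ≤∧≢⇒< (0≤x j) (λ 0≡xj → lj≢0 (trans (ℚP.+-identityʳ (x j)) (sym 0≡xj))) , ≤∧≢⇒< (x≤c j) xj≢c

    lowered-solution : A ·ℚ lowered ≗ toℚ ∘ b′
    lowered-solution r = begin
      (A ·ℚ lowered) r                                ≡⟨ ·ℚ-- A x (toℚ ∘ topPart) r ⟩
      (A ·ℚ x) r - (A ·ℚ (toℚ ∘ topPart)) r           ≡⟨ cong (_- (A ·ℚ (toℚ ∘ topPart)) r) (proj₂ (proj₂ sol) r) ⟩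
      (A ·ℚ (toℚ ∘ z)) r - (A ·ℚ (toℚ ∘ topPart)) r   ≡⟨ ·ℚ-- A (toℚ ∘ z) (toℚ ∘ topPart) r ⟨
      (A ·ℚ (λ j → toℚ (z j) - toℚ (topPart j))) r    ≡⟨ ·ℚ-cong A (λ j → toℚ-- (z j) (topPart j)) r ⟨
      (A ·ℚ (λ j → toℚ (z j ℤ.- topPart j))) r        ≡⟨ toℚ-·ℤ A (λ j → z j ℤ.- topPart j) r ⟨
      toℚ (b′ r)                                      ∎
      where open ≡-Reasoning

    lowered-isVertex : (∀ x′ → BoxSolution A c z x′ → interiorCount x′ ℕ.< interiorCount x → ⊥) →
                       IsVertex A b′ lowered
    lowered-isVertex minimal = (lowered-nonNeg , lowered-solution) , same
      where
      same : ∀ y w λ′ → InPolyhedron A b′ y → InPolyhedron A b′ w → 0ℚ < λ′ → λ′ < 1ℚ →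
             (∀ i → lowered i ≡ λ′ * y i + (1ℚ - λ′) * w i) → ∀ i → y i ≡ w i
      same y w λ′ (0≤y , Ay≡b′) (0≤w , Aw≡b′) 0<λ λ<1 lowered≡ i =
        decidable-stable (y i ℚP.≟ w i) λ yi≢wi →
          let x′ , sol′ , smaller = push-to-boundary sol d Ad≡0 d-support i (yi≢wi ∘ p-q≡0⇒p≡q (y i) (w i))
          in minimal x′ sol′ smaller
        where
        d : Column m → ℚ
        d j = y j - w j
        Ad≡0 : ∀ r → (A ·ℚ d) r ≡ 0ℚ
        Ad≡0 r = trans (·ℚ-- A y w r) (trans (cong₂ _-_ (Ay≡b′ r) (Aw≡b′ r)) (ℚP.+-inverseʳ (toℚ (b′ r))))
        d-support : ∀ j → d j ≢ 0ℚ → Interior x j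
        d-support j dj≢0 = lowered-support j λ lj≡0 →
          let yj≡0 , wj≡0 = convex-combination-zero (0≤y j) (0≤w j) 0<λ λ<1 (trans (sym (lowered≡ j)) lj≡0)
          in dj≢0 (cong₂ _-_ yj≡0 wj≡0)

    integral⇒integralBoxSolution : IsIntegral lowered → IntegralBoxSolution A c z
    integral⇒integralBoxSolution integral =
      u , u≤c , λ r → ·ℤ-from-·ℚ A (+_ ∘ u)
                        (trans (·ℚ-cong A u≡x r) (trans (proj₂ (proj₂ sol) r) (sym (toℚ-·ℤ A z r))))
      where
      a : Column m → ℤ
      a j = proj₁ (integral j) ℤ.+ topPart j
      x≡a : ∀ j → x j ≡ toℚ (a j)
      x≡a j = begin
        x j                                          ≡⟨ x-t+t≡x (x j) (toℚ (topPart j)) ⟨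
        lowered j + toℚ (topPart j)                  ≡⟨ cong (_+ toℚ (topPart j)) (proj₂ (integral j)) ⟩
        toℚ (proj₁ (integral j)) + toℚ (topPart j)   ≡⟨ toℚ-+ (proj₁ (integral j)) (topPart j) ⟨
        toℚ (a j)                                    ∎
        where
        open ≡-Reasoning
        x-t+t≡x : ∀ x t → x - t + t ≡ x
        x-t+t≡x = solve 2 (λ x t → x :- t :+ t := x) refl
      u : Column m → ℕ
      u j = ℤ.∣ a j ∣
      u≡x : ∀ j → toℚ (+ u j) ≡ x j
      u≡x j = trans (toℚ-∣∣ (a j) (subst (0ℚ ≤_) (x≡a j) (0≤x j))) (sym (x≡a j))
      u≤c : ∀ j → u j ℕ.≤ c j
      u≤c j = toℚ-ℕ-cancel-≤ (subst (_≤ cq j) (sym (u≡x j)) (x≤c j))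

  no-integral⇒no-boxSolution : IsUnimodular A → ¬ IntegralBoxSolution A c z →
                               ∀ k x → BoxSolution A c z x → interiorCount x ℕ.< k → ⊥
  no-integral⇒no-boxSolution unimodular ¬integral (suc k) x sol (ℕ.s≤s count≤k) =
    ¬integral (integral⇒integralBoxSolution
      (unimodular b′ (_ , λ r → refl) (lowered , lowered-nonNeg , lowered-solution) lowered
        (lowered-isVertex λ x′ sol′ smaller →
           no-integral⇒no-boxSolution unimodular ¬integral k x′ sol′ (ℕP.≤-trans smaller count≤k))))
    where open Lowering sol

unimodular⇒isBoxIntegral : ∀ {R m} (A : Matrix R m) → IsUnimodular A → DecidableFibres A → IsBoxIntegral A
unimodular⇒isBoxIntegral {m = m} A unimodular fibre? c z x sol =
  decidable-stable integral? λ ¬integral →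
    no-integral⇒no-boxSolution unimodular ¬integral (suc (interiorCount x)) x sol ℕP.≤-refl
  where
  open BoxSolutions A c z
  integral? : Dec (IntegralBoxSolution A c z)
  integral? = anyBelow? m c (λ u → fibre? (+_ ∘ u) z)
                (λ u≗v Au≡Az r → trans (·ℤ-cong A (cong +_ ∘ sym ∘ u≗v) r) (Au≡Az r))

-- Lawrence liftings

slice : ∀ {m} {X : Set} → Bool → (Column (suc m) → X) → Column m → X
slice t x′ i = x′ (i ∷ʳ t)

infixr 5 _∥_
_∥_ : ∀ {m} {X : Set} → (Column m → X) → (Column m → X) → Column (suc m) → X
(y ∥ x) j = if last j then y (init j) else x (init j)

slice-true-∥ : ∀ {m} {X : Set} (y x : Column m → X) → slice true (y ∥ x) ≗ y
slice-true-∥ y x i = cong₂ (λ b k → if b then y k else x k) (last-∷ʳ true i) (init-∷ʳ true i)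

slice-false-∥ : ∀ {m} {X : Set} (y x : Column m → X) → slice false (y ∥ x) ≗ x
slice-false-∥ y x i = cong₂ (λ b k → if b then y k else x k) (last-∷ʳ false i) (init-∷ʳ false i)

∘-∥ : ∀ {m} {X Y : Set} (f : X → Y) (y x : Column m → X) → f ∘ (y ∥ x) ≗ (f ∘ y) ∥ (f ∘ x)
∘-∥ f y x j with last j
... | true  = refl
... | false = refl

pairSum : ∀ {m} → (Column (suc m) → ℚ) → Column m → ℚ
pairSum x′ i = slice true x′ i + slice false x′ i

pairSum-∥ : ∀ {m} (y x : Column m → ℚ) → pairSum (y ∥ x) ≗ λ i → y i + x i
pairSum-∥ y x i = cong₂ _+_ (slice-true-∥ y x i) (slice-false-∥ y x i)

-- Up to repeated rows, L is the Lawrence lifting [[A, 0], [0, A], [I, I]] of A, the two column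
-- blocks being the columns i ∷ʳ true and i ∷ʳ false.
record LawrenceRows {R R′ : Set} {m : ℕ} (A : Matrix R m) (L : Matrix R′ (suc m)) : Set where
  field
    sliceRow : ∀ r t → Σ[ r′ ∈ R′ ] Represents L r′ (λ x′ → (A ·ℚ slice t x′) r)
    pairRow  : ∀ i → Σ[ r′ ∈ R′ ] Represents L r′ (λ x′ → pairSum x′ i)
    rowKind  : ∀ r′ → (Σ[ i ∈ Column m ] Represents L r′ (λ x′ → pairSum x′ i))
                    ⊎ (Σ[ r ∈ R ] Σ[ t ∈ Bool ] Represents L r′ (λ x′ → (A ·ℚ slice t x′) r))

module _ {R R′ : Set} {m : ℕ} {A : Matrix R m} {L : Matrix R′ (suc m)} (lawrence : LawrenceRows A L) where
  open LawrenceRows lawrence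

  ≗⇒slice-≗ : ∀ x′ y′ → L ·ℚ x′ ≗ L ·ℚ y′ → ∀ t → A ·ℚ slice t x′ ≗ A ·ℚ slice t y′
  ≗⇒slice-≗ x′ y′ Lx′≗Ly′ t r =
    let r′ , rep = sliceRow r t in trans (sym (rep x′)) (trans (Lx′≗Ly′ r′) (rep y′))

  ≗⇒pairSum-≗ : ∀ x′ y′ → L ·ℚ x′ ≗ L ·ℚ y′ → pairSum x′ ≗ pairSum y′
  ≗⇒pairSum-≗ x′ y′ Lx′≗Ly′ i =
    let r′ , rep = pairRow i in trans (sym (rep x′)) (trans (Lx′≗Ly′ r′) (rep y′))

  lawrence-≗ : ∀ x′ y′ → pairSum x′ ≗ pairSum y′ → A ·ℚ slice false x′ ≗ A ·ℚ slice false y′ →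
               L ·ℚ x′ ≗ L ·ℚ y′
  lawrence-≗ x′ y′ pair≗ false≗ r′ with rowKind r′
  ... | inj₁ (i , rep)         = trans (rep x′) (trans (pair≗ i) (sym (rep y′)))
  ... | inj₂ (r , false , rep) = trans (rep x′) (trans (false≗ r) (sym (rep y′)))
  ... | inj₂ (r , true , rep)  = trans (rep x′) (trans true≗ (sym (rep y′)))
    where
    p≡p+q-q : ∀ p q → p ≡ p + q - q
    p≡p+q-q = solve 2 (λ p q → p := p :+ q :- q) refl
    A·true : ∀ x′ → (A ·ℚ slice true x′) r ≡ (A ·ℚ pairSum x′) r - (A ·ℚ slice false x′) r
    A·true x′ = trans (·ℚ-cong A (λ i → p≡p+q-q (x′ (i ∷ʳ true)) (x′ (i ∷ʳ false))) r)
                      (·ℚ-- A (pairSum x′) (slice false x′) r)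
    true≗ : (A ·ℚ slice true x′) r ≡ (A ·ℚ slice true y′) r
    true≗ = trans (A·true x′) (trans (cong₂ _-_ (·ℚ-cong A pair≗ r) (false≗ r)) (sym (A·true y′)))

  ∥-≗ : ∀ y x y′ x′ → (∀ i → y i + x i ≡ y′ i + x′ i) → A ·ℚ x ≗ A ·ℚ x′ →
        L ·ℚ (y ∥ x) ≗ L ·ℚ (y′ ∥ x′)
  ∥-≗ y x y′ x′ sum≡ Ax≗Ax′ = lawrence-≗ (y ∥ x) (y′ ∥ x′)
    (λ i → trans (pairSum-∥ y x i) (trans (sum≡ i) (sym (pairSum-∥ y′ x′ i))))
    (λ r → trans (·ℚ-cong A (slice-false-∥ y x) r)
                 (trans (Ax≗Ax′ r) (sym (·ℚ-cong A (slice-false-∥ y′ x′) r))))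

  gap : (Column m → ℕ) → (Column m → ℤ) → Column m → ℤ
  gap c z i = + c i ℤ.- z i

  boxLift : (Column m → ℕ) → (Column m → ℤ) → Column (suc m) → ℤ
  boxLift c z = gap c z ∥ z

  toℚ-gap : ∀ c z i → toℚ (gap c z i) + toℚ (z i) ≡ toℚ (+ c i)
  toℚ-gap c z i = trans (cong (_+ toℚ (z i)) (toℚ-- (+ c i) (z i))) (p-q+q≡p (toℚ (+ c i)) (toℚ (z i)))

  pairSum-boxLift : ∀ c z → pairSum (toℚ ∘ boxLift c z) ≗ λ i → toℚ (+ c i)
  pairSum-boxLift c z i =
    trans (cong₂ (λ p q → toℚ p + toℚ q) (slice-true-∥ (gap c z) z i) (slice-false-∥ (gap c z) z i)) (toℚ-gap c z i)

  boxSolution⇒inCone : ∀ c z x → BoxSolution A c z x → InCone L (L ·ℤ boxLift c z)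
  boxSolution⇒inCone c z x (0≤x , x≤c , Ax≡Az) =
    x′ , 0≤x′ , λ r → trans (Lx′≗Lz′ r) (sym (toℚ-·ℤ L (boxLift c z) r))
    where
    x′ : Column (suc m) → ℚ
    x′ = (λ i → toℚ (+ c i) - x i) ∥ x
    0≤x′ : ∀ j → 0ℚ ≤ x′ j
    0≤x′ j with last j
    ... | true  = p≤q⇒0≤q-p (x≤c (init j))
    ... | false = 0≤x (init j)
    Lx′≗Lz′ : L ·ℚ x′ ≗ L ·ℚ (toℚ ∘ boxLift c z)
    Lx′≗Lz′ r = trans (∥-≗ (λ i → toℚ (+ c i) - x i) x (toℚ ∘ gap c z) (toℚ ∘ z)
                             (λ i → trans (p-q+q≡p (toℚ (+ c i)) (x i)) (sym (toℚ-gap c z i))) Ax≡Az r)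
                      (sym (·ℚ-cong L (∘-∥ toℚ (gap c z) z) r))

  inSemigroup⇒integralBoxSolution : ∀ c z → InSemigroup L (L ·ℤ boxLift c z) → IntegralBoxSolution A c z
  inSemigroup⇒integralBoxSolution c z (u′ , Lu′≡Lz′) = slice false u′ , u≤c , Au≡Az
    where
    Lu′≗Lz′ : L ·ℚ (toℚ ∘ +_ ∘ u′) ≗ L ·ℚ (toℚ ∘ boxLift c z)
    Lu′≗Lz′ r = trans (sym (toℚ-·ℤ L (+_ ∘ u′) r))
                      (trans (cong toℚ (Lu′≡Lz′ r)) (toℚ-·ℤ L (boxLift c z) r))
    u≤c : ∀ i → u′ (i ∷ʳ false) ℕ.≤ c i
    u≤c i = toℚ-ℕ-cancel-≤ {u′ (i ∷ʳ false)} {c i}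
      (subst₂ _≤_ (ℚP.+-identityˡ (toℚ (+ u′ (i ∷ʳ false))))
        (trans (≗⇒pairSum-≗ (toℚ ∘ +_ ∘ u′) (toℚ ∘ boxLift c z) Lu′≗Lz′ i) (pairSum-boxLift c z i))
        (ℚP.+-monoˡ-≤ (toℚ (+ u′ (i ∷ʳ false))) (toℚ-ℕ-nonNeg (u′ (i ∷ʳ true)))))
    Au≡Az : A ·ℕ slice false u′ ≗ A ·ℤ z
    Au≡Az r = ·ℤ-from-·ℚ A (+_ ∘ slice false u′)
      (trans (≗⇒slice-≗ (toℚ ∘ +_ ∘ u′) (toℚ ∘ boxLift c z) Lu′≗Lz′ false r)
        (trans (·ℚ-cong A (cong toℚ ∘ slice-false-∥ (gap c z) z) r) (sym (toℚ-·ℤ A z r))))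

  lawrence-normal⇒isBoxIntegral : IsNormal L → IsBoxIntegral A
  lawrence-normal⇒isBoxIntegral normal c z x sol = inSemigroup⇒integralBoxSolution c z
    (proj₁ (normal (L ·ℤ boxLift c z)) (boxSolution⇒inCone c z x sol , boxLift c z , λ _ → refl))

  isBoxIntegral⇒lawrence-normal : IsBoxIntegral A → IsNormal L
  isBoxIntegral⇒lawrence-normal boxIntegral b = cone∩lattice⊆semigroup , semigroup⊆cone∩lattice L b
    where
    cone∩lattice⊆semigroup : InCone L b × InLattice L b → InSemigroup L b
    cone∩lattice⊆semigroup ((x′ , 0≤x′ , Lx′≡b) , (z′ , Lz′≡b)) =
      u′ , λ r → ·ℤ-from-·ℚ L (+_ ∘ u′)
                   (trans (Lu′≗Lz′ r) (trans (sym (toℚ-·ℤ L z′ r)) (cong toℚ (Lz′≡b r))))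
      where
      Lx′≗Lz′ : L ·ℚ x′ ≗ L ·ℚ (toℚ ∘ z′)
      Lx′≗Lz′ r = trans (Lx′≡b r) (trans (cong toℚ (sym (Lz′≡b r))) (toℚ-·ℤ L z′ r))
      pair-x′≡pair-z′ : pairSum x′ ≗ pairSum (toℚ ∘ z′)
      pair-x′≡pair-z′ = ≗⇒pairSum-≗ x′ (toℚ ∘ z′) Lx′≗Lz′
      c : Column m → ℕ
      c i = ℤ.∣ z′ (i ∷ʳ true) ℤ.+ z′ (i ∷ʳ false) ∣
      c≡pair-x′ : ∀ i → toℚ (+ c i) ≡ pairSum x′ i
      c≡pair-x′ i = trans (toℚ-∣∣ (z′ (i ∷ʳ true) ℤ.+ z′ (i ∷ʳ false)) 0≤pair) pair≡
        where
        pair≡ : toℚ (z′ (i ∷ʳ true) ℤ.+ z′ (i ∷ʳ false)) ≡ pairSum x′ i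
        pair≡ = trans (toℚ-+ (z′ (i ∷ʳ true)) (z′ (i ∷ʳ false))) (sym (pair-x′≡pair-z′ i))
        0≤pair : 0ℚ ≤ toℚ (z′ (i ∷ʳ true) ℤ.+ z′ (i ∷ʳ false))
        0≤pair = subst (0ℚ ≤_) (sym pair≡) (nonNeg-+ (0≤x′ (i ∷ʳ true)) (0≤x′ (i ∷ʳ false)))
      x≤c : ∀ i → x′ (i ∷ʳ false) ≤ toℚ (+ c i)
      x≤c i = subst₂ _≤_ (ℚP.+-identityˡ (x′ (i ∷ʳ false))) (sym (c≡pair-x′ i))
                (ℚP.+-monoˡ-≤ (x′ (i ∷ʳ false)) (0≤x′ (i ∷ʳ true)))
      integral : IntegralBoxSolution A c (slice false z′)
      integral = boxIntegral c (slice false z′) (slice false x′)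
                   (0≤x′ ∘ (_∷ʳ false) , x≤c , ≗⇒slice-≗ x′ (toℚ ∘ z′) Lx′≗Lz′ false)
      u : Column m → ℕ
      u = proj₁ integral
      c-u : Column m → ℕ
      c-u i = c i ∸ u i
      u′ : Column (suc m) → ℕ
      u′ = c-u ∥ u
      c-u+u≡pair-z′ : ∀ i → toℚ (+ (c i ∸ u i)) + toℚ (+ u i) ≡ pairSum (toℚ ∘ z′) i
      c-u+u≡pair-z′ i = begin
        toℚ (+ (c i ∸ u i)) + toℚ (+ u i)    ≡⟨ toℚ-+ (+ (c i ∸ u i)) (+ u i) ⟨
        toℚ (+ (c i ∸ u i ℕ.+ u i))          ≡⟨ cong (toℚ ∘ +_) (ℕP.m∸n+n≡m (proj₁ (proj₂ integral) i)) ⟩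
        toℚ (+ c i)                          ≡⟨ trans (c≡pair-x′ i) (pair-x′≡pair-z′ i) ⟩
        pairSum (toℚ ∘ z′) i                 ∎
        where open ≡-Reasoning
      Au≡Az : A ·ℚ (toℚ ∘ +_ ∘ u) ≗ A ·ℚ slice false (toℚ ∘ z′)
      Au≡Az r = trans (sym (toℚ-·ℤ A (+_ ∘ u) r))
                      (trans (cong toℚ (proj₂ (proj₂ integral) r)) (toℚ-·ℤ A (slice false z′) r))
      Lu′≗Lz′ : L ·ℚ (toℚ ∘ +_ ∘ u′) ≗ L ·ℚ (toℚ ∘ z′)
      Lu′≗Lz′ r = trans (·ℚ-cong L (∘-∥ (toℚ ∘ +_) c-u u) r)
        (lawrence-≗ ((toℚ ∘ +_ ∘ c-u) ∥ (toℚ ∘ +_ ∘ u)) (toℚ ∘ z′)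
          (λ i → trans (pairSum-∥ (toℚ ∘ +_ ∘ c-u) (toℚ ∘ +_ ∘ u) i) (c-u+u≡pair-z′ i))
          (λ r → trans (·ℚ-cong A (slice-false-∥ (toℚ ∘ +_ ∘ c-u) (toℚ ∘ +_ ∘ u)) r) (Au≡Az r)) r)

coordinateRows-lift : ∀ {R R′ m} {A : Matrix R m} {L : Matrix R′ (suc m)} →
  (∀ r t → Σ[ r′ ∈ R′ ] Represents L r′ (λ x′ → (A ·ℚ slice t x′) r)) →
  CoordinateRows A → CoordinateRows L
coordinateRows-lift sliceRow rows j with initLast j
... | i , t , refl = let r , r≡xi = rows i ; r′ , r′≡Ar = sliceRow r t in
                     r′ , λ x′ → trans (r′≡Ar x′) (r≡xi (slice t x′))

-- The matrices 𝒜 C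

_==_ : ∀ {k} → Vec Bool k → Vec Bool k → Bool
u == v = does (≡-dec BoolP._≟_ u v)

indicator : Bool → ℚ
indicator b = toℚ (if b then + 1 else + 0)

sumℚ-indicator-== : ∀ m e (f : Column m → ℚ) → sumℚ m (λ i → indicator (i == e) * f i) ≡ f e
sumℚ-indicator-== zero    []        f = ℚP.*-identityˡ (f [])
sumℚ-indicator-== (suc m) (true ∷ e)  f = trans
  (cong₂ _+_ (sumℚ-indicator-== m e (f ∘ (true ∷_))) (sumℚ-zero m (λ i → ℚP.*-zeroˡ (f (false ∷ i)))))
  (ℚP.+-identityʳ _)
sumℚ-indicator-== (suc m) (false ∷ e) f = trans
  (cong₂ _+_ (sumℚ-zero m (λ i → ℚP.*-zeroˡ (f (true ∷ i)))) (sumℚ-indicator-== m e (f ∘ (false ∷_))))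
  (ℚP.+-identityˡ _)

restrict-∷ʳ : ∀ {k} (F i : Vec Bool k) a s → restrict (F ∷ʳ a) (i ∷ʳ s) ≡ restrict F i ∷ʳ (a ∧ s)
restrict-∷ʳ []      []      a s = refl
restrict-∷ʳ (x ∷ F) (y ∷ i) a s = cong ((x ∧ y) ∷_) (restrict-∷ʳ F i a s)

restrict-⊤ : ∀ {k} (i : Vec Bool k) → restrict ⊤ i ≡ i
restrict-⊤ []      = refl
restrict-⊤ (x ∷ i) = cong (x ∷_) (restrict-⊤ i)

==-∷ʳ : ∀ {k} (u v : Vec Bool k) s t → (u ∷ʳ s) == (v ∷ʳ t) ≡ does (s BoolP.≟ t) ∧ (u == v)
==-∷ʳ []      []      s t = refl
==-∷ʳ (x ∷ u) (y ∷ v) s t = trans (cong (does (x BoolP.≟ y) ∧_) (==-∷ʳ u v s t))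
                                  (∧-left-comm (does (x BoolP.≟ y)) (does (s BoolP.≟ t)) (u == v))

-- (𝒜 C ·ℚ x) (F , e , _) unfolds to rowSum F e x.
rowSum : ∀ {k} → Subset k → Vec Bool k → (Column k → ℚ) → ℚ
rowSum {k} F e x = sumℚ k (λ i → indicator (restrict F i == e) * x i)

rowSum-⊤ : ∀ {k} (e : Vec Bool k) x → rowSum ⊤ e x ≡ x e
rowSum-⊤ {k} e x = trans (sumℚ-cong k (λ i → cong (λ v → indicator (v == e) * x i) (restrict-⊤ i)))
                         (sumℚ-indicator-== k e x)

rowSum-∷ʳ : ∀ {k} (F : Subset k) a e s x′ → rowSum (F ∷ʳ a) (e ∷ʳ s) x′ ≡
  sumℚ k (λ i → indicator (does ((a ∧ true) BoolP.≟ s) ∧ (restrict F i == e)) * x′ (i ∷ʳ true)) +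
  sumℚ k (λ i → indicator (does ((a ∧ false) BoolP.≟ s) ∧ (restrict F i == e)) * x′ (i ∷ʳ false))
rowSum-∷ʳ {k} F a e s x′ = trans (sumℚ-last k (λ j → indicator (restrict (F ∷ʳ a) j == (e ∷ʳ s)) * x′ j))
                                 (cong₂ _+_ (sumℚ-cong k (entry true)) (sumℚ-cong k (entry false)))
  where
  entry : ∀ t i → indicator (restrict (F ∷ʳ a) (i ∷ʳ t) == (e ∷ʳ s)) * x′ (i ∷ʳ t) ≡
                  indicator (does ((a ∧ t) BoolP.≟ s) ∧ (restrict F i == e)) * x′ (i ∷ʳ t)
  entry t i = cong (λ b → indicator b * x′ (i ∷ʳ t))
                (trans (cong (_== (e ∷ʳ s)) (restrict-∷ʳ F i a t)) (==-∷ʳ (restrict F i) e (a ∧ t) s))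

rowSum-lift : ∀ {k} (F : Subset k) e t x′ → rowSum (F ∷ʳ true) (e ∷ʳ t) x′ ≡ rowSum F e (slice t x′)
rowSum-lift {k} F e true  x′ = trans (rowSum-∷ʳ F true e true x′)
  (trans (cong (λ q → rowSum F e (slice true x′) + q) (sumℚ-zero k (λ i → ℚP.*-zeroˡ (x′ (i ∷ʳ false)))))
         (ℚP.+-identityʳ _))
rowSum-lift {k} F e false x′ = trans (rowSum-∷ʳ F true e false x′)
  (trans (cong (_+ rowSum F e (slice false x′)) (sumℚ-zero k (λ i → ℚP.*-zeroˡ (x′ (i ∷ʳ true)))))
         (ℚP.+-identityˡ _))

rowSum-top : ∀ {k} (e : Vec Bool k) x′ → rowSum (⊤ ∷ʳ false) (e ∷ʳ false) x′ ≡ pairSum x′ e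
rowSum-top e x′ = trans (rowSum-∷ʳ ⊤ false e false x′)
                        (cong₂ _+_ (rowSum-⊤ e (slice true x′)) (rowSum-⊤ e (slice false x′)))

-- Lawrence liftings of simplicial complexes

head-inside : ∀ {n b} {q : Subset n} → (b ∷ q) [ Fin.zero ]= true → b ≡ true
head-inside here = refl

∷ʳ-⊆⁺ : ∀ {n} {F G : Subset n} {a b} → F ⊆ G → (a ≡ true → b ≡ true) → (F ∷ʳ a) ⊆ (G ∷ʳ b)
∷ʳ-⊆⁺ {F = []}    {[]}    _   a⇒b here rewrite a⇒b refl = here
∷ʳ-⊆⁺ {F = _ ∷ _} {_ ∷ _} F⊆G a⇒b here with F⊆G here
... | here = here
∷ʳ-⊆⁺ {F = _ ∷ _} {_ ∷ _} F⊆G a⇒b (there x∈F) = there (∷ʳ-⊆⁺ (drop-∷-⊆ F⊆G) a⇒b x∈F)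

∷ʳ-⊆⁻ : ∀ {n} {F G : Subset n} {a b} → (F ∷ʳ a) ⊆ (G ∷ʳ b) → F ⊆ G × (a ≡ true → b ≡ true)
∷ʳ-⊆⁻ {F = []}    {[]}    Fa⊆Gb = (λ ()) , λ { refl → head-inside (Fa⊆Gb here) }
∷ʳ-⊆⁻ {F = _ ∷ F} {_ ∷ G} {a} {b} Fa⊆Gb =
  (λ { here → subst (λ y → (y ∷ _) [ Fin.zero ]= true) (sym (head-inside (Fa⊆Gb here))) here
     ; (there x∈F) → there (proj₁ tail x∈F) }) ,
  proj₂ tail
  where
  tail : F ⊆ G × (a ≡ true → b ≡ true)
  tail = ∷ʳ-⊆⁻ (drop-∷-⊆ Fa⊆Gb)

module _ {n : ℕ} (C : SimplicialComplex n) where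

  lawrence-generator : ∀ {G′} → G′ ∈ Lawrence C → G′ ≡ ⊤ ∷ʳ false ⊎ ∃[ G ] G ∈ C × G′ ≡ G ∷ʳ true
  lawrence-generator (hereˡ G′≡⊤) = inj₁ G′≡⊤
  lawrence-generator (thereˡ G′∈) = inj₂ (∈-map⁻ (_∷ʳ true) G′∈)

  lift-isFace : ∀ {F} → IsFace C F → IsFace (Lawrence C) (F ∷ʳ true)
  lift-isFace (G , G∈C , F⊆G) =
    G ∷ʳ true , thereˡ (∈-map⁺ (_∷ʳ true) G∈C) , ∷ʳ-⊆⁺ F⊆G (λ a≡true → a≡true)

  lower-isFace : ∀ {F} → IsFace (Lawrence C) (F ∷ʳ true) → IsFace C F
  lower-isFace (G′ , G′∈ , F⊆G′) with lawrence-generator G′∈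
  ... | inj₁ refl             = case proj₂ (∷ʳ-⊆⁻ F⊆G′) refl of λ ()
  ... | inj₂ (G , G∈C , refl) = G , G∈C , proj₁ (∷ʳ-⊆⁻ F⊆G′)

  lift-isFacet : ∀ {F} → IsFacet C F → IsFacet (Lawrence C) (F ∷ʳ true)
  lift-isFacet {F} (face , maximal) = lift-isFace face , maximal′
    where
    maximal′ : ∀ G′ → IsFace (Lawrence C) G′ → F ∷ʳ true ⊆ G′ → G′ ≡ F ∷ʳ true
    maximal′ G′ face′ F⊆G′ with initLast G′
    ... | G , a , refl with ∷ʳ-⊆⁻ {F = F} {G} F⊆G′
    ... | F⊆G , t⇒a with t⇒a refl
    ... | refl = cong (_∷ʳ true) (maximal G (lower-isFace face′) F⊆G)

  top-isFacet : ¬ IsFace C ⊤ → IsFacet (Lawrence C) (⊤ ∷ʳ false)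
  top-isFacet ⊤∉C = (⊤ ∷ʳ false , hereˡ refl , λ x∈ → x∈) , maximal
    where
    maximal : ∀ G′ → IsFace (Lawrence C) G′ → ⊤ ∷ʳ false ⊆ G′ → G′ ≡ ⊤ ∷ʳ false
    maximal G′ (H′ , H′∈ , G′⊆H′) ⊤⊆G′ with lawrence-generator H′∈
    ... | inj₁ refl             = ⊆-antisym G′⊆H′ ⊤⊆G′
    ... | inj₂ (H , H∈C , refl) = ⊥-elim (⊤∉C (H , H∈C , proj₁ (∷ʳ-⊆⁻ (G′⊆H′ ∘ ⊤⊆G′))))

  lawrence-facet : ∀ {F′} → IsFacet (Lawrence C) F′ →
                   F′ ≡ ⊤ ∷ʳ false ⊎ ∃[ F ] IsFacet C F × F′ ≡ F ∷ʳ true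
  lawrence-facet {F′} facet with initLast F′
  lawrence-facet (face , maximal) | F , true , refl = inj₂ (F , (lower-isFace face , maximalC) , refl)
    where
    maximalC : ∀ G → IsFace C G → F ⊆ G → G ≡ F
    maximalC G faceG F⊆G =
      proj₁ (∷ʳ-injective G F (maximal (G ∷ʳ true) (lift-isFace faceG) (∷ʳ-⊆⁺ F⊆G (λ t → t))))
  lawrence-facet ((H′ , H′∈ , F⊆H′) , maximal) | F , false , refl with lawrence-generator H′∈
  ... | inj₁ refl = inj₁ (sym (maximal (⊤ ∷ʳ false) (⊤ ∷ʳ false , hereˡ refl , λ x∈ → x∈) F⊆H′))
  ... | inj₂ (H , H∈C , refl) = case proj₂ (∷ʳ-injective F F F⊤≡F⊥) of λ ()
    where
    F⊤≡F⊥ : F ∷ʳ true ≡ F ∷ʳ false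
    F⊤≡F⊥ = maximal (F ∷ʳ true) (lift-isFace (H , H∈C , proj₁ (∷ʳ-⊆⁻ F⊆H′)))
                    (∷ʳ-⊆⁺ (λ x∈ → x∈) (λ ()))

  isFace? : ∀ F → Dec (IsFace C F)
  isFace? F = map′ find (λ (G , G∈C , F⊆G) → lose G∈C F⊆G) (any? (F ⊆?_) C)

  isFacet? : ∀ F → Dec (IsFacet C F)
  isFacet? F = isFace? F ×-dec allSubsets? (λ G → isFace? G →-dec F ⊆? G →-dec ≡-dec BoolP._≟_ G F)

  𝒜-decidableFibres : DecidableFibres (𝒜 C)
  𝒜-decidableFibres u v = map′ (λ all (F , e , facet , e≡) → all F e facet e≡)
                               (λ all F e facet e≡ → all (F , e , facet , e≡))
                               (allSubsets? λ F → allSubsets? λ e → row? F e)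
    where
    -- The entries of the row (F , e , facet , e≡) do not depend on facet and e≡.
    row? : ∀ F e → Dec (∀ facet e≡ → (𝒜 C ·ℤ u) (F , e , facet , e≡) ≡ (𝒜 C ·ℤ v) (F , e , facet , e≡))
    row? F e with isFacet? F | ≡-dec BoolP._≟_ e (restrict F e)
    ... | no ¬facet | _      = yes λ facet → ⊥-elim (¬facet facet)
    ... | yes _     | no e≢  = yes λ _ e≡ → ⊥-elim (e≢ e≡)
    ... | yes facet | yes e≡ = map′ (λ eq _ _ → eq) (λ all → all facet e≡) (_ ℤ.≟ _)

  𝒜-coordinateRows : IsFace C ⊤ → CoordinateRows (𝒜 C)
  𝒜-coordinateRows ⊤∈C e =
    (⊤ , e , (⊤∈C , λ G _ ⊤⊆G → ⊆-antisym ⊆⊤ ⊤⊆G) , sym (restrict-⊤ e)) , rowSum-⊤ e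

  𝒜-sliceRow : ∀ r t →
               Σ[ r′ ∈ Row (Lawrence C) ] Represents (𝒜 (Lawrence C)) r′ (λ x′ → (𝒜 C ·ℚ slice t x′) r)
  𝒜-sliceRow (F , e , facet , e≡) t =
    (F ∷ʳ true , e ∷ʳ t , lift-isFacet facet , trans (cong (_∷ʳ t) e≡) (sym (restrict-∷ʳ F e true t))) ,
    rowSum-lift F e t

  𝒜-lawrenceRows : ¬ IsFace C ⊤ → LawrenceRows (𝒜 C) (𝒜 (Lawrence C))
  𝒜-lawrenceRows ⊤∉C = record { sliceRow = 𝒜-sliceRow ; pairRow = pairRow ; rowKind = rowKind }
    where
    pairRow : ∀ i → Σ[ r′ ∈ Row (Lawrence C) ] Represents (𝒜 (Lawrence C)) r′ (λ x′ → pairSum x′ i)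
    pairRow e = (⊤ ∷ʳ false , e ∷ʳ false , top-isFacet ⊤∉C ,
                 sym (trans (restrict-∷ʳ ⊤ e false false) (cong (_∷ʳ false) (restrict-⊤ e)))) ,
                rowSum-top e
    rowKind : ∀ r′ →
      (Σ[ i ∈ Column n ] Represents (𝒜 (Lawrence C)) r′ (λ x′ → pairSum x′ i)) ⊎
      (Σ[ r ∈ Row C ] Σ[ t ∈ Bool ] Represents (𝒜 (Lawrence C)) r′ (λ x′ → (𝒜 C ·ℚ slice t x′) r))
    rowKind (F′ , e′ , facet , e′≡) with lawrence-facet facet | initLast e′
    ... | inj₁ refl | e , s , refl with proj₂ (∷ʳ-injective e (restrict ⊤ e) (trans e′≡ (restrict-∷ʳ ⊤ e false s)))
    ...   | refl = inj₁ (e , rowSum-top e)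
    rowKind (F′ , e′ , facet , e′≡) | inj₂ (F , facetF , refl) | e , t , refl =
      inj₂ ((F , e , facetF , proj₁ (∷ʳ-injective e (restrict F e) (trans e′≡ (restrict-∷ʳ F e true t)))) ,
            t , rowSum-lift F e t)

theorem3p7 : (n : ℕ) (C : SimplicialComplex n) →
    (IsNormal (𝒜 (Lawrence C)) → IsUnimodular (𝒜 C)) ×
    (IsUnimodular (𝒜 C) → IsNormal (𝒜 (Lawrence C)))
theorem3p7 n C with isFace? C ⊤
... | yes ⊤∈C =
  (λ _ → coordinateRows⇒unimodular (𝒜 C) rows) ,
  (λ _ → coordinateRows⇒normal (𝒜 (Lawrence C))
           (coordinateRows-lift {A = 𝒜 C} {L = 𝒜 (Lawrence C)} (𝒜-sliceRow C) rows))
  where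
  rows : CoordinateRows (𝒜 C)
  rows = 𝒜-coordinateRows C ⊤∈C
... | no ⊤∉C =
  isBoxIntegral⇒unimodular (𝒜 C) ∘ lawrence-normal⇒isBoxIntegral lawrence ,
  λ unimodular →
    isBoxIntegral⇒lawrence-normal lawrence (unimodular⇒isBoxIntegral (𝒜 C) unimodular (𝒜-decidableFibres C))
  where
  lawrence : LawrenceRows (𝒜 C) (𝒜 (Lawrence C))
  lawrence = 𝒜-lawrenceRows C ⊤∉C
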